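{- Let $n$ be odd, and for $0\le i\le n-1$ let $(f_S(\check\Phi^n_i))_{S\subseteq[n]}$ be the flag $f$-vector associated with $\check\Phi^n_i(c,d)$. Then for every nonempty $S=\{s_1<\dots<s_k\}\subseteq[n]$, \[ \sum_{i=\lfloor n/2\rfloor+1}^{n-1}(-1)^i\binom{n}{i}f_S(\check\Phi^n_i)=\binom{n}{s_k}\binom{s_k}{s_1,\,s_2-s_1,\,\dots,\,s_k-s_{k-1}}\sum_{\lfloor n/2\rfloor+1\le j\le s_k}(-1)^j\binom{s_k}{j}+\delta_{S,\{n\}}, \] where $\delta_{S,\{n\}}=1$ if $S=\{n\}$ and $0$ otherwise, and $\binom{s_k}{s_1,\dots,s_k-s_{k-1}}$ is a multinomial coefficient.
   Context: For $S\subseteq[n]$, $u_S=u_1\cdots u_n$ is the monomial in non-commuting $a,b$ with $u_i=b$ iff $i\in S$, else $u_i=a$. For a homogeneous polynomial $\Phi(c,d)$ of degree $n$ in non-commuting variables $c$ (degree 1) and $d$ (degree 2), its associated flag $f$-vector $(f_S(\Phi))_{S\subseteq[n]}$ is defined by writing $\Phi(a+b,ab+ba)=\sum_{S\subseteq[n]}h_Su_S$ and setting $f_S(\Phi)=\sum_{T\subseteq S}h_T$ (equivalently $\sum_S f_S(\Phi)u_S=\Phi(c,d)|_{c=2a... }$ is the polynomial $\chi$ with $\chi(a-b,b)=\Phi(a+b,ab+ba)$); this is the linear map sending the $cd$-index of an Eulerian poset to its flag $f$-vector (flag $f$-vector: $f_S(P)$ counts chains $\hat0<x_1<\dots<x_k<\hat1$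 whose ranks are the elements of $S$). The polynomials $\check\Phi^n_i$: let $\Lambda^n$ be the boundary complex of an $n$-simplex with facets $\sigma_0,\dots,\sigma_n$. For $0\le i\le n-1$ let $\Gamma^n_i$ be the simplicial complex generated by $\sigma_0,\dots,\sigma_i$, and $\Lambda^n_i$ the regular CW complex obtained from $\Gamma^n_i$ by attaching a new $(n-1)$-cell $\tau$ with $\partial\tau=\partial\Gamma^n_i$. The face poset of $\Lambda^n_i$ with $\hat0,\hat1$ adjoined is Eulerian of rank $n+1$ (every interval has equally many elements of odd and even rank); let $\Phi_{\Lambda^n_i}$ be its $cd$-index, i.e. the polynomial with $\Phi(a+b,ab+ba)=\sum_S h_S u_S$ where $h_S=\sum_{T\subseteq S}(-1)^{|S\setminus T|}f_T$. Set $\check\Phi^n_0=\Phi_{\Lambda^n_0}$, $\check\Phi^n_i=\Phi_{\Lambda^n_i}-\Phi_{\Lambda^n_{i-1}}$ for $1\le i\le n-1$. -}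

module Defs where

open import Data.Bool using (Bool; true; false; _∧_; not; if_then_else_)
open import Data.Nat using (ℕ; zero; suc; _+_; _*_; _∸_; _!; _/_; _≤ᵇ_; _<ᵇ_; NonZero)
open import Data.Nat.Properties using (m*n≢0; _!≢0)
open import Data.Nat.Combinatorics using (_C_)
open import Data.Integer as ℤ using (ℤ; +_; -_)
open import Data.Fin using (Fin; toℕ)
open import Data.Fin.Subset using (Subset; ∣_∣)
open import Data.Vec using (Vec; []; _∷_; lookup)
open import Data.List using (List; []; _∷_; map; concatMap; filterᵇ; allFin; upTo; foldr)
open import Data.Bool.ListAction using (any; all)
open import Data.Nat.ListAction using (sum)
open import Relation.Nullary.Decidable using (⌊_⌋)
open import Data.List.Properties using (≡-dec)
import Data.Nat as N

allSubsets : (m : ℕ) → List (Subset m)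
allSubsets zero = [] ∷ []
allSubsets (suc m) = concatMap (λ v → (true ∷ v) ∷ (false ∷ v) ∷ []) (allSubsets m)

range : ℕ → ℕ → List ℕ
range a b = map (λ k → a + k) (upTo (suc b ∸ a))

sumRange : ℕ → ℕ → (ℕ → ℤ) → ℤ
sumRange a b f = foldr (λ i acc → f i ℤ.+ acc) (+ 0) (range a b)

sgn : ℕ → ℤ
sgn i = (- (+ 1)) ℤ.^ i

prodFact : List ℕ → ℕ
prodFact [] = 1
prodFact (k ∷ ks) = k ! * prodFact ks

prodFact≢0 : (ks : List ℕ) → NonZero (prodFact ks)
prodFact≢0 [] = _
prodFact≢0 (k ∷ ks) = m*n≢0 (k !) (prodFact ks) {{k !≢0}} {{prodFact≢0 ks}}

multinomial : List ℕ → ℕ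
multinomial ks = (sum ks ! / prodFact ks) {{prodFact≢0 ks}}

-- Subsets S ⊆ [n] = {1,…,n}: a subset S : Subset n contains the rank
-- r = toℕ p + 1 iff position p is true.

elemsOf : {n : ℕ} → Subset n → List ℕ
elemsOf {n} S = map (λ p → suc (toℕ p)) (filterᵇ (λ p → lookup S p) (allFin n))

maxOf : List ℕ → ℕ
maxOf [] = 0
maxOf (x ∷ []) = x
maxOf (x ∷ y ∷ ys) = maxOf (y ∷ ys)

gapsFrom : ℕ → List ℕ → List ℕ
gapsFrom prev [] = []
gapsFrom prev (x ∷ xs) = (x ∸ prev) ∷ gapsFrom x xs

delta : (n : ℕ) → Subset n → ℤ
delta n S = if ⌊ ≡-dec N._≟_ (elemsOf S) (n ∷ []) ⌋ then + 1 else + 0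

-- The face poset of Λⁿᵢ (with 0̂ adjoined; 1̂ is implicit).
-- Vertices of the n-simplex: Fin (suc n) = {0,…,n}.  Facet σⱼ is the
-- facet opposite vertex j, i.e. σⱼ = {0,…,n} ∖ {j}.
-- Γⁿᵢ = complex generated by σ₀,…,σᵢ: a face F lies in Γⁿᵢ iff F misses
-- some vertex j ≤ i.  The boundary ∂Γⁿᵢ consists of faces contained in a
-- ridge σⱼ ∩ σₗ lying in exactly one facet of Γⁿᵢ, i.e. F misses some
-- j ≤ i and some l > i.

data Elem (n : ℕ) : Set where
  bot  : Elem n
  face : Subset (suc n) → Elem n   -- a nonempty face of Γⁿᵢ
  tau  : Elem n                    -- the new (n-1)-cell τ

inΓ : {n : ℕ} → ℕ → Subset (suc n) → Bool
inΓ {n} i F = any (λ j → (toℕ j ≤ᵇ i) ∧ not (lookup F j)) (allFin (suc n))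

inBoundary : {n : ℕ} → ℕ → Subset (suc n) → Bool
inBoundary {n} i F =
  any (λ j → any (λ l → (toℕ j ≤ᵇ i) ∧ (i <ᵇ toℕ l) ∧ not (lookup F j) ∧ not (lookup F l))
                 (allFin (suc n)))
      (allFin (suc n))

subsetᵇ : {m : ℕ} → Subset m → Subset m → Bool
subsetᵇ {m} F G = all (λ p → not (lookup F p) Data.Bool.∨ lookup G p) (allFin m)
  where import Data.Bool

rank : {n : ℕ} → Elem n → ℕ
rank bot = 0
rank (face F) = ∣ F ∣
rank {n} tau = n

lt : {n : ℕ} → ℕ → Elem n → Elem n → Bool
lt i bot bot = false
lt i bot (face _) = true
lt i bot tau = true
lt i (face F) bot = false
lt i (face F) (face G) = subsetᵇ F G ∧ (∣ F ∣ <ᵇ ∣ G ∣)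
lt i (face F) tau = inBoundary i F
lt i tau _ = false

cells : (n i : ℕ) → List (Elem n)
cells n i = map face (filterᵇ (λ F → (0 <ᵇ ∣ F ∣) ∧ inΓ i F) (allSubsets (suc n))) Data.List.++ (tau ∷ [])
  where import Data.List

chainsAbove : (n i : ℕ) → Elem n → List ℕ → ℕ
chainsAbove n i x [] = 1
chainsAbove n i x (r ∷ rs) =
  sum (map (λ y → chainsAbove n i y rs)
           (filterᵇ (λ y → (rank y N.≡ᵇ r) ∧ lt i x y) (cells n i)))

flagF : (n i : ℕ) → Subset n → ℕ
flagF n i S = chainsAbove n i bot (elemsOf S)

-- f_S(Φ̌ⁿᵢ): by linearity of the cd-index → flag f-vector map and
-- f_S(Φ_{Λⁿᵢ}) = f_S(Λⁿᵢ)
fCheck : (n i : ℕ) → Subset n → ℤ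
fCheck n zero S = + flagF n zero S
fCheck n (suc i) S = + flagF n (suc i) S ℤ.- + flagF n i S

{-# OPTIONS --safe #-}
-- Let n = 2q + 1 and S = {s₁ < ⋯ < s_k}, s = s_k.  A chain of Λⁿᵢ with ranks S ends either in
-- an s-face of Γⁿᵢ, below which lie M = (s choose s₁, s₂ − s₁, …) chains, or, when s = n, in τ.
-- Γⁿᵢ arises from Γⁿᵢ₋₁ by adding the C(n − i, s − i) s-faces that contain {0, …, i − 1} but
-- not i, and C(n, i) C(n − i, s − i) = C(n, s) C(s, i); so the faces contribute
-- C(n, s) M ∑_{q < i < n} (−1)ⁱ C(s, i), which is the right-hand side except for its summand
-- j = n, present only when s = n.  The chains ending in τ do not depend on i if s < n or
-- S = {n}, and in the latter case δ = 1 makes up for the missing summand.  Otherwise they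
-- number M / C(n, t) times the t-faces of ∂Γⁿᵢ, where t = s_{k−1}; inclusion–exclusion over
-- the faces containing {0, …, i} or {i + 1, …, n} gives how that number changes with i, and
-- the reflected alternating sum ∑_{q < i < n} (−1)ⁱ (C(t, i) − C(t, n − i)) = −1 accounts for
-- the missing summand.

module Submission where

open import Defs

module ListSums where

  open import Data.Bool using (Bool; true; false; _∧_)
  open import Data.Nat using (ℕ; _+_; _*_)
  open import Data.Nat.Properties
  open import Data.Nat.ListAction using (sum)
  open import Data.List using (List; []; _∷_; map; filterᵇ; _++_; concatMap)
  open import Function using (_∘_)
  open import Algebra.Properties.CommutativeSemigroup +-commutativeSemigroup using (interchange)
  open import Relation.Binary.PropositionalEquality
  open ≡-Reasoning

  χ : Bool → ℕ → ℕ
  χ true  x = x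
  χ false x = 0

  χ-zero : ∀ b → χ b 0 ≡ 0
  χ-zero true  = refl
  χ-zero false = refl

  χ-∧ : ∀ a b x → χ (a ∧ b) x ≡ χ a (χ b x)
  χ-∧ true  b x = refl
  χ-∧ false b x = refl

  χ-comm : ∀ a b x → χ a (χ b x) ≡ χ b (χ a x)
  χ-comm true  b x = refl
  χ-comm false b x = sym (χ-zero b)

  χ-*ʳ : ∀ a x c → χ a x * c ≡ χ a (x * c)
  χ-*ʳ true  x c = refl
  χ-*ʳ false x c = refl

  χ-1-* : ∀ a x → χ a 1 * x ≡ χ a x
  χ-1-* true  x = *-identityˡ x
  χ-1-* false x = refl

  ∑ : {A : Set} → List A → (A → ℕ) → ℕ
  ∑ xs g = sum (map g xs)

  module _ {A : Set} where

    ∑-cong : ∀ {g h : A → ℕ} xs → (∀ x → g x ≡ h x) → ∑ xs g ≡ ∑ xs h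
    ∑-cong []       g≗h = refl
    ∑-cong (x ∷ xs) g≗h = cong₂ _+_ (g≗h x) (∑-cong xs g≗h)

    ∑-zero : ∀ {g : A → ℕ} xs → (∀ x → g x ≡ 0) → ∑ xs g ≡ 0
    ∑-zero []       g≗0 = refl
    ∑-zero (x ∷ xs) g≗0 = cong₂ _+_ (g≗0 x) (∑-zero xs g≗0)

    ∑-++ : ∀ (g : A → ℕ) xs ys → ∑ (xs ++ ys) g ≡ ∑ xs g + ∑ ys g
    ∑-++ g []       ys = refl
    ∑-++ g (x ∷ xs) ys = trans (cong (g x +_) (∑-++ g xs ys)) (sym (+-assoc (g x) _ _))

    ∑-filterᵇ : ∀ (p : A → Bool) (g : A → ℕ) xs → ∑ (filterᵇ p xs) g ≡ ∑ xs (λ x → χ (p x) (g x))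
    ∑-filterᵇ p g []       = refl
    ∑-filterᵇ p g (x ∷ xs) with p x
    ... | true  = cong (g x +_) (∑-filterᵇ p g xs)
    ... | false = ∑-filterᵇ p g xs

    ∑-distrib-+ : ∀ (g h : A → ℕ) xs → ∑ xs (λ x → g x + h x) ≡ ∑ xs g + ∑ xs h
    ∑-distrib-+ g h []       = refl
    ∑-distrib-+ g h (x ∷ xs) = begin
      g x + h x + ∑ xs (λ x → g x + h x) ≡⟨ cong (g x + h x +_) (∑-distrib-+ g h xs) ⟩
      g x + h x + (∑ xs g + ∑ xs h)      ≡⟨ interchange (g x) (h x) (∑ xs g) (∑ xs h) ⟩
      g x + ∑ xs g + (h x + ∑ xs h)      ∎

    ∑-*ʳ : ∀ (g : A → ℕ) c xs → ∑ xs g * c ≡ ∑ xs (λ x → g x * c)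
    ∑-*ʳ g c []       = refl
    ∑-*ʳ g c (x ∷ xs) = trans (*-distribʳ-+ c (g x) (∑ xs g)) (cong (g x * c +_) (∑-*ʳ g c xs))

    χ-∑ : ∀ a xs (g : A → ℕ) → χ a (∑ xs g) ≡ ∑ xs (λ x → χ a (g x))
    χ-∑ true  xs g = refl
    χ-∑ false xs g = sym (∑-zero xs (λ _ → refl))

  module _ {A B : Set} where

    ∑-map : ∀ (f : A → B) (g : B → ℕ) xs → ∑ (map f xs) g ≡ ∑ xs (g ∘ f)
    ∑-map f g []       = refl
    ∑-map f g (x ∷ xs) = cong (g (f x) +_) (∑-map f g xs)

    ∑-concatMap : ∀ (f : A → List B) (g : B → ℕ) xs → ∑ (concatMap f xs) g ≡ ∑ xs (λ x → ∑ (f x) g)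
    ∑-concatMap f g []       = refl
    ∑-concatMap f g (x ∷ xs) = trans (∑-++ g (f x) (concatMap f xs)) (cong (∑ (f x) g +_) (∑-concatMap f g xs))

    ∑-comm : ∀ (f : A → B → ℕ) xs (ys : List B) →
             ∑ xs (λ x → ∑ ys (f x)) ≡ ∑ ys (λ y → ∑ xs (λ x → f x y))
    ∑-comm f []       ys = sym (∑-zero ys (λ _ → refl))
    ∑-comm f (x ∷ xs) ys = begin
      ∑ ys (f x) + ∑ xs (λ x → ∑ ys (f x))          ≡⟨ cong (∑ ys (f x) +_) (∑-comm f xs ys) ⟩
      ∑ ys (f x) + ∑ ys (λ y → ∑ xs (λ x → f x y))  ≡⟨ ∑-distrib-+ (f x) _ ys ⟨
      ∑ ys (λ y → f x y + ∑ xs (λ x → f x y))       ∎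

module NatTests where

  open import Data.Bool using (true; false)
  open import Data.Bool.Properties using (T-≡)
  open import Data.Nat using (_<_; _≡ᵇ_; _<ᵇ_)
  open import Data.Nat.Properties using (≡ᵇ⇒≡; ≡⇒≡ᵇ; <⇒<ᵇ)
  open import Function.Bundles using (module Equivalence)
  open import Relation.Binary.PropositionalEquality
  open import Relation.Nullary using (contradiction)

  ≡ᵇ-true⇒≡ : ∀ m n → (m ≡ᵇ n) ≡ true → m ≡ n
  ≡ᵇ-true⇒≡ m n eq = ≡ᵇ⇒≡ m n (Equivalence.from T-≡ eq)

  ≡⇒≡ᵇ-true : ∀ {m n} → m ≡ n → (m ≡ᵇ n) ≡ true
  ≡⇒≡ᵇ-true {m} {n} m≡n = Equivalence.to T-≡ (≡⇒≡ᵇ m n m≡n)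

  ≢⇒≡ᵇ-false : ∀ {m n} → m ≢ n → (m ≡ᵇ n) ≡ false
  ≢⇒≡ᵇ-false {m} {n} m≢n with m ≡ᵇ n in eq
  ... | false = refl
  ... | true  = contradiction (≡ᵇ-true⇒≡ m n eq) m≢n

  <⇒<ᵇ-true : ∀ {m n} → m < n → (m <ᵇ n) ≡ true
  <⇒<ᵇ-true m<n = Equivalence.to T-≡ (<⇒<ᵇ m<n)

module Faces where

  open import Data.Bool using (Bool; true; false; _∧_; _∨_; not)
  open import Data.Bool.Properties using (∨-identityʳ; ∧-distribʳ-∨; ∧-zeroʳ)
  open import Data.Bool.ListAction using (any; or; and)
  open import Data.Nat using (ℕ; zero; suc; _≤ᵇ_; _<ᵇ_)
  open import Data.List using (List; []; _∷_; tabulate; allFin)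
  open import Data.List.Properties using (tabulate-cong; map-tabulate; map-cong)
  open import Data.Fin using (Fin; toℕ)
  open import Data.Fin.Subset using (Subset)
  open import Data.Vec using ([]; _∷_; lookup)
  open import Function using (id)
  open import Relation.Binary.PropositionalEquality
  open ≡-Reasoning

  missesUpTo : {m : ℕ} → ℕ → Subset m → Bool
  missesUpTo i       []      = false
  missesUpTo zero    (b ∷ F) = not b
  missesUpTo (suc i) (b ∷ F) = not b ∨ missesUpTo i F

  missesSome : {m : ℕ} → Subset m → Bool
  missesSome []      = false
  missesSome (b ∷ F) = not b ∨ missesSome F

  missesAbove : {m : ℕ} → ℕ → Subset m → Bool
  missesAbove i       []      = false
  missesAbove zero    (b ∷ F) = missesSome F
  missesAbove (suc i) (b ∷ F) = missesAbove i F

  inBoundaryOf : {m : ℕ} → ℕ → Subset m → Bool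
  inBoundaryOf i F = missesUpTo i F ∧ missesAbove i F

  infix 7 _⊆ᵇ_
  _⊆ᵇ_ : {m : ℕ} → Subset m → Subset m → Bool
  []      ⊆ᵇ []      = true
  (x ∷ F) ⊆ᵇ (y ∷ G) = (not x ∨ y) ∧ (F ⊆ᵇ G)

  private
    or-false : ∀ m → or (tabulate (λ (_ : Fin m) → false)) ≡ false
    or-false zero    = refl
    or-false (suc m) = or-false m

    suc≤ᵇsuc : ∀ x i → (suc x ≤ᵇ suc i) ≡ (x ≤ᵇ i)
    suc≤ᵇsuc zero    i = refl
    suc≤ᵇsuc (suc x) i = refl

    or-missesUpTo : ∀ {m} (F : Subset m) i →
                    or (tabulate (λ j → (toℕ j ≤ᵇ i) ∧ not (lookup F j))) ≡ missesUpTo i F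
    or-missesUpTo []               i       = refl
    or-missesUpTo {suc m} (b ∷ F) zero    = trans (cong (not b ∨_) (or-false m)) (∨-identityʳ (not b))
    or-missesUpTo (b ∷ F)         (suc i) = cong (not b ∨_) (trans
      (cong or (tabulate-cong (λ j → cong (_∧ not (lookup F j)) (suc≤ᵇsuc (toℕ j) i))))
      (or-missesUpTo F i))

    or-missesSome : ∀ {m} (F : Subset m) → or (tabulate (λ j → not (lookup F j))) ≡ missesSome F
    or-missesSome []      = refl
    or-missesSome (b ∷ F) = cong (not b ∨_) (or-missesSome F)

    or-missesAbove : ∀ {m} (F : Subset m) i →
                     or (tabulate (λ j → (i <ᵇ toℕ j) ∧ not (lookup F j))) ≡ missesAbove i F
    or-missesAbove []      i       = refl
    or-missesAbove (b ∷ F) zero    = or-missesSome F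
    or-missesAbove (b ∷ F) (suc i) = or-missesAbove F i

    and-⊆ᵇ : ∀ {m} (F G : Subset m) → and (tabulate (λ p → not (lookup F p) ∨ lookup G p)) ≡ (F ⊆ᵇ G)
    and-⊆ᵇ []      []      = refl
    and-⊆ᵇ (x ∷ F) (y ∷ G) = cong ((not x ∨ y) ∧_) (and-⊆ᵇ F G)

    any-∧ˡ : {A : Set} (a c : Bool) (b d : A → Bool) (xs : List A) →
             any (λ l → a ∧ (b l ∧ (c ∧ d l))) xs ≡ (a ∧ c) ∧ any (λ l → b l ∧ d l) xs
    any-∧ˡ a c b d [] = sym (∧-zeroʳ (a ∧ c))
    any-∧ˡ a c b d (x ∷ xs) with a | c | b x | d x
    ... | false | _     | _     | _     = any-∧ˡ false c b d xs
    ... | true  | false | bx    | _     = trans (cong (_∨ _) (∧-zeroʳ bx)) (any-∧ˡ true false b d xs)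
    ... | true  | true  | false | _     = any-∧ˡ true true b d xs
    ... | true  | true  | true  | false = any-∧ˡ true true b d xs
    ... | true  | true  | true  | true  = refl

    any-∧ʳ : {A : Set} (p : A → Bool) (c : Bool) (xs : List A) → any (λ j → p j ∧ c) xs ≡ any p xs ∧ c
    any-∧ʳ p c []       = refl
    any-∧ʳ p c (x ∷ xs) = trans (cong (p x ∧ c ∨_) (any-∧ʳ p c xs)) (sym (∧-distribʳ-∨ c (p x) (any p xs)))

  inΓ≡missesUpTo : ∀ {n} i (F : Subset (suc n)) → inΓ i F ≡ missesUpTo i F
  inΓ≡missesUpTo i F =
    trans (cong or (map-tabulate id (λ j → (toℕ j ≤ᵇ i) ∧ not (lookup F j)))) (or-missesUpTo F i)

  subsetᵇ≡⊆ᵇ : ∀ {m} (F G : Subset m) → subsetᵇ F G ≡ (F ⊆ᵇ G)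
  subsetᵇ≡⊆ᵇ F G = trans (cong and (map-tabulate id (λ p → not (lookup F p) ∨ lookup G p))) (and-⊆ᵇ F G)

  inBoundary≡inBoundaryOf : ∀ {n} i (F : Subset (suc n)) → inBoundary i F ≡ inBoundaryOf i F
  inBoundary≡inBoundaryOf {n} i F = begin
    inBoundary i F
      ≡⟨ cong or (map-cong (λ j → any-∧ˡ (toℕ j ≤ᵇ i) (not (lookup F j)) (λ l → i <ᵇ toℕ l) (λ l → not (lookup F l)) vertices)
                           vertices) ⟩
    any (λ j → missesAt≤ j ∧ any missesAt> vertices) vertices
      ≡⟨ any-∧ʳ missesAt≤ (any missesAt> vertices) vertices ⟩
    any missesAt≤ vertices ∧ any missesAt> vertices
      ≡⟨ cong₂ _∧_ (inΓ≡missesUpTo i F) (trans (cong or (map-tabulate id missesAt>)) (or-missesAbove F i)) ⟩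
    inBoundaryOf i F ∎
    where
    vertices = allFin (suc n)
    missesAt≤ missesAt> : Fin (suc n) → Bool
    missesAt≤ j = (toℕ j ≤ᵇ i) ∧ not (lookup F j)
    missesAt> l = (i <ᵇ toℕ l) ∧ not (lookup F l)

module SubsetCounts where

  open ListSums
  open Faces
  open NatTests
  open import Data.Bool using (Bool; true; false; _∧_; not)
  open import Data.Bool.Properties using (∧-zeroʳ)
  open import Data.Nat using (ℕ; zero; suc; _+_; _∸_; _≤_; _<_; z≤n; s≤s; _≡ᵇ_)
  open import Data.Nat.Properties
  open import Data.Nat.Combinatorics using (_C_; nCk+nC[k+1]≡[n+1]C[k+1])
  open import Data.Fin.Subset using (Subset; ∣_∣)
  open import Data.Vec using ([]; _∷_)
  open import Function using (_∘_)
  open import Algebra.Properties.CommutativeSemigroup +-commutativeSemigroup using (interchange)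
  open import Relation.Binary.PropositionalEquality
  open ≡-Reasoning

  -- The number of r-element supersets of a fixed b-set inside an (a + b)-set.
  supersets : ℕ → ℕ → ℕ → ℕ
  supersets a zero    r       = a C r
  supersets a (suc b) zero    = 0
  supersets a (suc b) (suc r) = supersets a b r

  supersets-pascal : ∀ a b r → supersets (suc a) b r ≡ supersets a b r + supersets a (suc b) r
  supersets-pascal a zero    zero    = refl
  supersets-pascal a zero    (suc r) = trans (sym (nCk+nC[k+1]≡[n+1]C[k+1] a r)) (+-comm (a C r) (a C suc r))
  supersets-pascal a (suc b) zero    = refl
  supersets-pascal a (suc b) (suc r) = supersets-pascal a b r

  supersets-pascal′ : ∀ a b r → supersets a b r + supersets a b (suc r) ≡ supersets (suc a) b (suc r)
  supersets-pascal′ a b r = trans (+-comm (supersets a b r) _) (sym (supersets-pascal a b (suc r)))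

  supersets-zero : ∀ a a′ b → supersets a b 0 ≡ supersets a′ b 0
  supersets-zero a a′ zero    = refl
  supersets-zero a a′ (suc b) = refl

  supersets-≥ : ∀ a {b r} → b ≤ r → supersets a b r ≡ a C (r ∸ b)
  supersets-≥ a {zero}          b≤r       = refl
  supersets-≥ a {suc b} {suc r} (s≤s b≤r) = supersets-≥ a b≤r

  supersets-< : ∀ a {b r} → r < b → supersets a b r ≡ 0
  supersets-< a {suc b} {zero}  r<b       = refl
  supersets-< a {suc b} {suc r} (s≤s r<b) = supersets-< a r<b

  count : (m : ℕ) → (Subset m → Bool) → ℕ → ℕ
  count m P t = ∑ (allSubsets m) (λ F → χ (P F) (χ (∣ F ∣ ≡ᵇ t) 1))

  count-cong : ∀ {m} {P Q : Subset m → Bool} → (∀ F → P F ≡ Q F) → ∀ t → count m P t ≡ count m Q t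
  count-cong {m} P≗Q t = ∑-cong (allSubsets m) (λ F → cong (λ b → χ b _) (P≗Q F))

  count-false : ∀ m t → count m (λ _ → false) t ≡ 0
  count-false m t = ∑-zero (allSubsets m) (λ _ → refl)

  private
    ∑-allSubsets-suc : ∀ m (g : Subset (suc m) → ℕ) →
                       ∑ (allSubsets (suc m)) g ≡ ∑ (allSubsets m) (λ v → g (true ∷ v) + g (false ∷ v))
    ∑-allSubsets-suc m g = trans (∑-concatMap _ g (allSubsets m))
      (∑-cong (allSubsets m) (λ v → cong (g (true ∷ v) +_) (+-identityʳ (g (false ∷ v)))))

  count-suc-zero : ∀ {m} (P : Subset (suc m) → Bool) → count (suc m) P 0 ≡ count m (λ v → P (false ∷ v)) 0
  count-suc-zero {m} P = trans (∑-allSubsets-suc m _)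
    (∑-cong (allSubsets m) (λ v → cong (_+ χ (P (false ∷ v)) (χ (∣ v ∣ ≡ᵇ 0) 1)) (χ-zero (P (true ∷ v)))))

  count-suc-suc : ∀ {m} (P : Subset (suc m) → Bool) t →
                  count (suc m) P (suc t) ≡ count m (λ v → P (true ∷ v)) t + count m (λ v → P (false ∷ v)) (suc t)
  count-suc-suc {m} P t = trans (∑-allSubsets-suc m _) (∑-distrib-+ _ _ (allSubsets m))

  module _ {m} (P : Subset (suc m) → Bool) (Q : Subset m → Bool) where

    count-ignoringHead : (∀ x v → P (x ∷ v) ≡ Q v) → ∀ a b → (∀ t → count m Q t ≡ supersets a b t) →
                         ∀ t → count (suc m) P t ≡ supersets (suc a) b t
    count-ignoringHead P≗Q a b Q-count zero = begin
      count (suc m) P 0     ≡⟨ trans (count-suc-zero P) (count-cong (P≗Q false) 0) ⟩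
      count m Q 0           ≡⟨ trans (Q-count 0) (supersets-zero a (suc a) b) ⟩
      supersets (suc a) b 0 ∎
    count-ignoringHead P≗Q a b Q-count (suc t) = begin
      count (suc m) P (suc t)
        ≡⟨ count-suc-suc P t ⟩
      count m (λ v → P (true ∷ v)) t + count m (λ v → P (false ∷ v)) (suc t)
        ≡⟨ cong₂ _+_ (count-cong (P≗Q true) t) (count-cong (P≗Q false) (suc t)) ⟩
      count m Q t + count m Q (suc t)
        ≡⟨ cong₂ _+_ (Q-count t) (Q-count (suc t)) ⟩
      supersets a b t + supersets a b (suc t)
        ≡⟨ supersets-pascal′ a b t ⟩
      supersets (suc a) b (suc t) ∎

    count-requiringHead : (∀ v → P (true ∷ v) ≡ Q v) → (∀ v → P (false ∷ v) ≡ false) →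
                          ∀ a b → (∀ t → count m Q t ≡ supersets a b t) →
                          ∀ t → count (suc m) P t ≡ supersets a (suc b) t
    count-requiringHead _ P-false a b Q-count zero =
      trans (count-suc-zero P) (trans (count-cong P-false 0) (count-false m 0))
    count-requiringHead P≗Q P-false a b Q-count (suc t) = begin
      count (suc m) P (suc t)
        ≡⟨ count-suc-suc P t ⟩
      count m (λ v → P (true ∷ v)) t + count m (λ v → P (false ∷ v)) (suc t)
        ≡⟨ cong₂ _+_ (count-cong P≗Q t) (trans (count-cong P-false (suc t)) (count-false m (suc t))) ⟩
      count m Q t + 0
        ≡⟨ trans (+-identityʳ _) (Q-count t) ⟩
      supersets a b t ∎

  count-all : ∀ m t → count m (λ _ → true) t ≡ m C t
  count-all zero    zero    = refl
  count-all zero    (suc t) = refl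
  count-all (suc m)         = count-ignoringHead {m} (λ _ → true) (λ _ → true) (λ _ _ → refl) m 0 (count-all m)

  count-not : ∀ {m} (P : Subset m → Bool) t → count m P t + count m (not ∘ P) t ≡ m C t
  count-not {m} P t = trans (sym (∑-distrib-+ _ _ (allSubsets m)))
    (trans (∑-cong (allSubsets m) split) (count-all m t))
    where
    split : ∀ F → χ (P F) (χ (∣ F ∣ ≡ᵇ t) 1) + χ (not (P F)) (χ (∣ F ∣ ≡ᵇ t) 1) ≡ χ (∣ F ∣ ≡ᵇ t) 1
    split F with P F
    ... | true  = +-identityʳ _
    ... | false = refl

  count-full : ∀ m t → count m (not ∘ missesSome) t ≡ supersets 0 m t
  count-full zero    zero    = refl
  count-full zero    (suc t) = refl
  count-full (suc m)         =
    count-requiringHead {m} (not ∘ missesSome) (not ∘ missesSome) (λ _ → refl) (λ _ → refl) 0 m (count-full m)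

  count-containingUpTo : ∀ {m} i → i < m → ∀ t → count m (not ∘ missesUpTo i) t ≡ supersets (m ∸ suc i) (suc i) t
  count-containingUpTo {suc m} zero    _         =
    count-requiringHead {m} (not ∘ missesUpTo 0) (λ _ → true) (λ _ → refl) (λ _ → refl) m 0 (count-all m)
  count-containingUpTo {suc m} (suc i) (s≤s i<m) =
    count-requiringHead {m} (not ∘ missesUpTo (suc i)) (not ∘ missesUpTo i) (λ _ → refl) (λ _ → refl)
                        (m ∸ suc i) (suc i) (count-containingUpTo i i<m)

  count-containingAbove : ∀ {m} i → i < m → ∀ t → count m (not ∘ missesAbove i) t ≡ supersets (suc i) (m ∸ suc i) t
  count-containingAbove {suc m} zero    _         =
    count-ignoringHead {m} (not ∘ missesAbove 0) (not ∘ missesSome) (λ _ _ → refl) 0 m (count-full m)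
  count-containingAbove {suc m} (suc i) (s≤s i<m) =
    count-ignoringHead {m} (not ∘ missesAbove (suc i)) (not ∘ missesAbove i) (λ _ _ → refl)
                       (suc i) (m ∸ suc i) (count-containingAbove i i<m)

  ⊆ᵇ⇒∣∣≤ : ∀ {m} (F G : Subset m) → F ⊆ᵇ G ≡ true → ∣ F ∣ ≤ ∣ G ∣
  ⊆ᵇ⇒∣∣≤ []          []          _   = z≤n
  ⊆ᵇ⇒∣∣≤ (true ∷ F)  (true ∷ G)  F⊆G = s≤s (⊆ᵇ⇒∣∣≤ F G F⊆G)
  ⊆ᵇ⇒∣∣≤ (false ∷ F) (true ∷ G)  F⊆G = m≤n⇒m≤1+n (⊆ᵇ⇒∣∣≤ F G F⊆G)
  ⊆ᵇ⇒∣∣≤ (false ∷ F) (false ∷ G) F⊆G = ⊆ᵇ⇒∣∣≤ F G F⊆G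

  inInterval : ∀ {m} → Subset m → Subset m → Subset m → Bool
  inInterval F G H = F ⊆ᵇ H ∧ H ⊆ᵇ G

  count-interval : ∀ {m} (F G : Subset m) r →
                   count m (inInterval F G) r ≡ χ (F ⊆ᵇ G) (supersets (∣ G ∣ ∸ ∣ F ∣) ∣ F ∣ r)
  count-interval [] [] zero    = refl
  count-interval [] [] (suc r) = refl
  count-interval {suc m} (false ∷ F) (false ∷ G) zero =
    trans (count-suc-zero (inInterval (false ∷ F) (false ∷ G))) (count-interval F G 0)
  count-interval {suc m} (false ∷ F) (false ∷ G) (suc r) = begin
    count (suc m) (inInterval (false ∷ F) (false ∷ G)) (suc r)
      ≡⟨ count-suc-suc (inInterval (false ∷ F) (false ∷ G)) r ⟩
    count m (λ H → F ⊆ᵇ H ∧ false) r + count m (inInterval F G) (suc r)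
      ≡⟨ cong (_+ count m (inInterval F G) (suc r)) (trans (count-cong (λ H → ∧-zeroʳ (F ⊆ᵇ H)) r) (count-false m r)) ⟩
    count m (inInterval F G) (suc r)
      ≡⟨ count-interval F G (suc r) ⟩
    χ (F ⊆ᵇ G) (supersets (∣ G ∣ ∸ ∣ F ∣) ∣ F ∣ (suc r)) ∎
  count-interval {suc m} (true ∷ F) (false ∷ G) r = trans (count-cong outside r) (count-false (suc m) r)
    where
    outside : ∀ H → inInterval (true ∷ F) (false ∷ G) H ≡ false
    outside (true ∷ H)  = ∧-zeroʳ (F ⊆ᵇ H)
    outside (false ∷ H) = refl
  count-interval {suc m} (true ∷ F) (true ∷ G) zero = begin
    count (suc m) (inInterval (true ∷ F) (true ∷ G)) 0 ≡⟨ count-suc-zero (inInterval (true ∷ F) (true ∷ G)) ⟩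
    count m (λ _ → false) 0                            ≡⟨ count-false m 0 ⟩
    0                                                  ≡⟨ χ-zero (F ⊆ᵇ G) ⟨
    χ (F ⊆ᵇ G) 0                                       ∎
  count-interval {suc m} (true ∷ F) (true ∷ G) (suc r) = begin
    count (suc m) (inInterval (true ∷ F) (true ∷ G)) (suc r)
      ≡⟨ count-suc-suc (inInterval (true ∷ F) (true ∷ G)) r ⟩
    count m (inInterval F G) r + count m (λ _ → false) (suc r)
      ≡⟨ cong (count m (inInterval F G) r +_) (count-false m (suc r)) ⟩
    count m (inInterval F G) r + 0
      ≡⟨ trans (+-identityʳ _) (count-interval F G r) ⟩
    χ (F ⊆ᵇ G) (supersets (∣ G ∣ ∸ ∣ F ∣) ∣ F ∣ r) ∎
  count-interval {suc m} (false ∷ F) (true ∷ G) zero =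
    trans (count-suc-zero (inInterval (false ∷ F) (true ∷ G)))
          (trans (count-interval F G 0) (cong (χ (F ⊆ᵇ G)) (supersets-zero _ _ ∣ F ∣)))
  count-interval {suc m} (false ∷ F) (true ∷ G) (suc r) = begin
    count (suc m) (inInterval (false ∷ F) (true ∷ G)) (suc r)
      ≡⟨ count-suc-suc (inInterval (false ∷ F) (true ∷ G)) r ⟩
    count m (inInterval F G) r + count m (inInterval F G) (suc r)
      ≡⟨ cong₂ _+_ (count-interval F G r) (count-interval F G (suc r)) ⟩
    χ (F ⊆ᵇ G) (supersets a ∣ F ∣ r) + χ (F ⊆ᵇ G) (supersets a ∣ F ∣ (suc r))
      ≡⟨ pascal (F ⊆ᵇ G) refl ⟩
    χ (F ⊆ᵇ G) (supersets (suc ∣ G ∣ ∸ ∣ F ∣) ∣ F ∣ (suc r)) ∎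
    where
    a = ∣ G ∣ ∸ ∣ F ∣
    pascal : ∀ b → F ⊆ᵇ G ≡ b → χ b (supersets a ∣ F ∣ r) + χ b (supersets a ∣ F ∣ (suc r))
                                ≡ χ b (supersets (suc ∣ G ∣ ∸ ∣ F ∣) ∣ F ∣ (suc r))
    pascal false _   = refl
    pascal true  F⊆G = trans (supersets-pascal′ a ∣ F ∣ r)
      (cong (λ c → supersets c ∣ F ∣ (suc r)) (sym (+-∸-assoc 1 (⊆ᵇ⇒∣∣≤ F G F⊆G))))

  containsAll⇒full : ∀ {m} (F : Subset m) → not (missesSome F) ≡ true → ∣ F ∣ ≡ m
  containsAll⇒full []         _ = refl
  containsAll⇒full (true ∷ F) h = cong suc (containsAll⇒full F h)

  containsUpToAndAbove⇒full : ∀ {m} i (F : Subset m) →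
    not (missesUpTo i F) ≡ true → not (missesAbove i F) ≡ true → ∣ F ∣ ≡ m
  containsUpToAndAbove⇒full i       []         _ _ = refl
  containsUpToAndAbove⇒full zero    (true ∷ F) _ h = cong suc (containsAll⇒full F h)
  containsUpToAndAbove⇒full (suc i) (true ∷ F) h h′ = cong suc (containsUpToAndAbove⇒full i F h h′)

  count-missesUpTo : ∀ {m} i → i < m → ∀ s → count m (missesUpTo i) s + supersets (m ∸ suc i) (suc i) s ≡ m C s
  count-missesUpTo {m} i i<m s =
    trans (cong (count m (missesUpTo i) s +_) (sym (count-containingUpTo i i<m s))) (count-not (missesUpTo i) s)

  -- Inclusion–exclusion: a t-set with t < m misses some vertex, so it cannot contain both
  -- {0, …, i} and its complement.
  count-inBoundaryOf : ∀ {m} i → i < m → ∀ {t} → t < m →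
    count m (inBoundaryOf i) t + supersets (m ∸ suc i) (suc i) t + supersets (suc i) (m ∸ suc i) t ≡ m C t
  count-inBoundaryOf {m} i i<m {t} t<m = begin
    count m (inBoundaryOf i) t + supersets (m ∸ suc i) (suc i) t + supersets (suc i) (m ∸ suc i) t
      ≡⟨ cong₂ (λ a b → count m (inBoundaryOf i) t + a + b) (count-containingUpTo i i<m t) (count-containingAbove i i<m t) ⟨
    count m (inBoundaryOf i) t + count m (not ∘ missesUpTo i) t + count m (not ∘ missesAbove i) t
      ≡⟨ cong (_+ count m (not ∘ missesAbove i) t) (∑-distrib-+ _ _ (allSubsets m)) ⟨
    ∑ (allSubsets m) (λ F → χ (inBoundaryOf i F) (size≡t F) + χ (not (missesUpTo i F)) (size≡t F))
      + count m (not ∘ missesAbove i) t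
      ≡⟨ ∑-distrib-+ _ _ (allSubsets m) ⟨
    ∑ (allSubsets m) (λ F → χ (inBoundaryOf i F) (size≡t F) + χ (not (missesUpTo i F)) (size≡t F)
                            + χ (not (missesAbove i F)) (size≡t F))
      ≡⟨ ∑-cong (allSubsets m) (λ F → partition F refl refl) ⟩
    count m (λ _ → true) t
      ≡⟨ count-all m t ⟩
    m C t ∎
    where
    size≡t : Subset m → ℕ
    size≡t F = χ (∣ F ∣ ≡ᵇ t) 1
    size≢t : ∀ F → ∣ F ∣ ≡ m → size≡t F ≡ 0
    size≢t F ∣F∣≡m = cong (λ b → χ b 1) (trans (cong (_≡ᵇ t) ∣F∣≡m) (≢⇒≡ᵇ-false (>⇒≢ t<m)))
    partition : ∀ F {u a} → missesUpTo i F ≡ u → missesAbove i F ≡ a →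
                χ (u ∧ a) (size≡t F) + χ (not u) (size≡t F) + χ (not a) (size≡t F) ≡ size≡t F
    partition F {true}  {true}  _ _ = trans (+-identityʳ _) (+-identityʳ _)
    partition F {true}  {false} _ _ = refl
    partition F {false} {true}  _ _ = +-identityʳ _
    partition F {false} {false} u a = trans (cong (λ z → z + z) v≡0) (sym v≡0)
      where v≡0 = size≢t F (containsUpToAndAbove⇒full i F (cong not u) (cong not a))

  count-missesUpTo-suc : ∀ {m} i → suc i < m → ∀ s →
    count m (missesUpTo (suc i)) s ≡ count m (missesUpTo i) s + supersets (m ∸ suc (suc i)) (suc i) s
  count-missesUpTo-suc {m} i i+1<m s = +-cancelʳ-≡ (supersets a (suc (suc i)) s) _ _ (begin
    count m (missesUpTo (suc i)) s + supersets a (suc (suc i)) s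
      ≡⟨ count-missesUpTo (suc i) i+1<m s ⟩
    m C s
      ≡⟨ count-missesUpTo i (<-trans (n<1+n i) i+1<m) s ⟨
    Γᵢ + supersets (m ∸ suc i) (suc i) s
      ≡⟨ cong (λ c → Γᵢ + supersets c (suc i) s) (+-∸-assoc 1 i+1<m) ⟩
    Γᵢ + supersets (suc a) (suc i) s
      ≡⟨ cong (Γᵢ +_) (supersets-pascal a (suc i) s) ⟩
    Γᵢ + (supersets a (suc i) s + supersets a (suc (suc i)) s)
      ≡⟨ +-assoc Γᵢ _ _ ⟨
    Γᵢ + supersets a (suc i) s + supersets a (suc (suc i)) s ∎)
    where
    a  = m ∸ suc (suc i)
    Γᵢ = count m (missesUpTo i) s

  count-inBoundaryOf-suc : ∀ {m} i → suc i < m → ∀ {t} → t < m →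
    count m (inBoundaryOf (suc i)) t + supersets (suc i) (m ∸ suc (suc i)) t
      ≡ count m (inBoundaryOf i) t + supersets (m ∸ suc (suc i)) (suc i) t
  count-inBoundaryOf-suc {m} i i+1<m {t} t<m = +-cancelʳ-≡ (x + y) _ _ (begin
    ∂ᵢ₊₁ + supersets (suc i) a t + (x + y)
      ≡⟨ interchange ∂ᵢ₊₁ _ x y ⟩
    ∂ᵢ₊₁ + x + (supersets (suc i) a t + y)
      ≡⟨ cong (∂ᵢ₊₁ + x +_) (supersets-pascal (suc i) a t) ⟨
    ∂ᵢ₊₁ + x + supersets (suc (suc i)) a t
      ≡⟨ count-inBoundaryOf (suc i) i+1<m t<m ⟩
    m C t
      ≡⟨ count-inBoundaryOf i (<-trans (n<1+n i) i+1<m) t<m ⟨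
    ∂ᵢ + supersets (m ∸ suc i) (suc i) t + supersets (suc i) (m ∸ suc i) t
      ≡⟨ cong (λ c → ∂ᵢ + supersets c (suc i) t + supersets (suc i) c t) (+-∸-assoc 1 i+1<m) ⟩
    ∂ᵢ + supersets (suc a) (suc i) t + y
      ≡⟨ cong (λ z → ∂ᵢ + z + y) (supersets-pascal a (suc i) t) ⟩
    ∂ᵢ + (supersets a (suc i) t + x) + y
      ≡⟨ cong (_+ y) (+-assoc ∂ᵢ _ x) ⟨
    ∂ᵢ + supersets a (suc i) t + x + y
      ≡⟨ +-assoc (∂ᵢ + supersets a (suc i) t) x y ⟩
    ∂ᵢ + supersets a (suc i) t + (x + y) ∎)
    where
    a    = m ∸ suc (suc i)
    x    = supersets a (suc (suc i)) t
    y    = supersets (suc i) (suc a) t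
    ∂ᵢ   = count m (inBoundaryOf i) t
    ∂ᵢ₊₁ = count m (inBoundaryOf (suc i)) t

module Multinomials where

  open SubsetCounts using (supersets; supersets-≥; supersets-<)
  open import Data.Unit using (⊤)
  open import Data.Product using (_×_; _,_)
  open import Data.Nat using (ℕ; _+_; _*_; _∸_; _≤_; _<_; _!; _/_; NonZero)
  open import Data.Nat.Properties
  open import Data.Nat.DivMod using (m/n*n≡m; m*n/n≡m; /-congˡ)
  open import Data.Nat.Combinatorics using (_C_; nCk≡n!/k![n-k]!; k![n∸k]!∣n!; nCn≡1; k>n⇒nCk≡0; nCk≡nC[n∸k])
  open import Data.Nat.Solver using (module +-*-Solver)
  open import Data.Nat.ListAction using (sum)
  open import Data.List using (List; []; _∷_; _++_)
  open import Relation.Binary.PropositionalEquality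
  open import Relation.Nullary using (yes; no)
  open ≡-Reasoning
  open +-*-Solver using (solve; _:*_; _:=_)

  nCk*k![n∸k]!≡n! : ∀ {n k} → k ≤ n → (n C k) * (k ! * (n ∸ k) !) ≡ n !
  nCk*k![n∸k]!≡n! {n} {k} k≤n = begin
    (n C k) * (k ! * (n ∸ k) !)                   ≡⟨ cong (_* (k ! * (n ∸ k) !)) (nCk≡n!/k![n-k]! k≤n) ⟩
    (n ! / (k ! * (n ∸ k) !)) * (k ! * (n ∸ k) !) ≡⟨ m/n*n≡m (k![n∸k]!∣n! k≤n) ⟩
    n !                                           ∎
    where instance _ = k !* (n ∸ k) !≢0

  nCi*[n∸i]C[s∸i]≡nCs*sCi : ∀ {n i s} → i ≤ s → s ≤ n → (n C i) * ((n ∸ i) C (s ∸ i)) ≡ (n C s) * (s C i)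
  nCi*[n∸i]C[s∸i]≡nCs*sCi {n} {i} {s} i≤s s≤n = *-cancelʳ-≡ _ _ (x * (y * z)) (trans lhs (sym rhs))
    where
    x = i !
    y = (s ∸ i) !
    z = (n ∸ s) !
    instance
      _ : NonZero (x * (y * z))
      _ = m*n≢0 x (y * z) {{i !≢0}} {{m*n≢0 y z {{(s ∸ i) !≢0}} {{(n ∸ s) !≢0}}}}
    n∸i∸[s∸i]≡n∸s : (n ∸ i) ∸ (s ∸ i) ≡ n ∸ s
    n∸i∸[s∸i]≡n∸s = trans (∸-+-assoc n i (s ∸ i)) (cong (n ∸_) (m+[n∸m]≡n i≤s))
    lhs : (n C i) * ((n ∸ i) C (s ∸ i)) * (x * (y * z)) ≡ n !
    lhs = begin
      (n C i) * ((n ∸ i) C (s ∸ i)) * (x * (y * z))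
        ≡⟨ solve 5 (λ a b x y z → a :* b :* (x :* (y :* z)) := (a :* x) :* (b :* (y :* z)))
                 refl (n C i) ((n ∸ i) C (s ∸ i)) x y z ⟩
      ((n C i) * x) * (((n ∸ i) C (s ∸ i)) * (y * z))
        ≡⟨ cong (λ w → ((n C i) * x) * (((n ∸ i) C (s ∸ i)) * (y * w !))) n∸i∸[s∸i]≡n∸s ⟨
      ((n C i) * x) * (((n ∸ i) C (s ∸ i)) * (y * ((n ∸ i) ∸ (s ∸ i)) !))
        ≡⟨ cong (((n C i) * x) *_) (nCk*k![n∸k]!≡n! (∸-monoˡ-≤ i s≤n)) ⟩
      ((n C i) * x) * (n ∸ i) !
        ≡⟨ *-assoc (n C i) x ((n ∸ i) !) ⟩
      (n C i) * (x * (n ∸ i) !)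
        ≡⟨ nCk*k![n∸k]!≡n! (≤-trans i≤s s≤n) ⟩
      n ! ∎
    rhs : (n C s) * (s C i) * (x * (y * z)) ≡ n !
    rhs = begin
      (n C s) * (s C i) * (x * (y * z))
        ≡⟨ solve 5 (λ a b x y z → a :* b :* (x :* (y :* z)) := a :* ((b :* (x :* y)) :* z)) refl (n C s) (s C i) x y z ⟩
      (n C s) * (((s C i) * (x * y)) * z) ≡⟨ cong (λ w → (n C s) * (w * z)) (nCk*k![n∸k]!≡n! i≤s) ⟩
      (n C s) * (s ! * z)                 ≡⟨ nCk*k![n∸k]!≡n! s≤n ⟩
      n !                                 ∎

  nCi*supersets≡nCs*sCi : ∀ n i {s} → s ≤ n → (n C i) * supersets (n ∸ i) i s ≡ (n C s) * (s C i)
  nCi*supersets≡nCs*sCi n i {s} s≤n with i ≤? s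
  ... | yes i≤s = trans (cong ((n C i) *_) (supersets-≥ (n ∸ i) i≤s)) (nCi*[n∸i]C[s∸i]≡nCs*sCi i≤s s≤n)
  ... | no  i≰s = begin
    (n C i) * supersets (n ∸ i) i s ≡⟨ cong ((n C i) *_) (supersets-< (n ∸ i) (≰⇒> i≰s)) ⟩
    (n C i) * 0                     ≡⟨ *-zeroʳ (n C i) ⟩
    0                               ≡⟨ *-zeroʳ (n C s) ⟨
    (n C s) * 0                     ≡⟨ cong ((n C s) *_) (k>n⇒nCk≡0 (≰⇒> i≰s)) ⟨
    (n C s) * (s C i)               ∎

  nCi*supersets≡nCt*tC[n∸i] : ∀ {n i t} → i ≤ n → t ≤ n → (n C i) * supersets i (n ∸ i) t ≡ (n C t) * (t C (n ∸ i))
  nCi*supersets≡nCt*tC[n∸i] {n} {i} {t} i≤n t≤n = begin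
    (n C i) * supersets i (n ∸ i) t
      ≡⟨ cong₂ (λ a b → a * supersets b (n ∸ i) t) (nCk≡nC[n∸k] i≤n) (sym (m∸[m∸n]≡n i≤n)) ⟩
    (n C (n ∸ i)) * supersets (n ∸ (n ∸ i)) (n ∸ i) t
      ≡⟨ nCi*supersets≡nCs*sCi n (n ∸ i) t≤n ⟩
    (n C t) * (t C (n ∸ i)) ∎

  private
    multinomial-∷-via : ∀ a ks → prodFact ks * multinomial ks ≡ sum ks ! →
                        multinomial (a ∷ ks) ≡ ((a + sum ks) C a) * multinomial ks
    multinomial-∷-via a ks P*M≡s! = begin
      (a + s) ! / (a ! * P)                 ≡⟨ /-congˡ [a+s]!≡ ⟩
      (c * M) * (a ! * P) / (a ! * P)       ≡⟨ m*n/n≡m (c * M) (a ! * P) ⟩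
      c * M                                 ∎
      where
      s = sum ks
      P = prodFact ks
      M = multinomial ks
      c = (a + s) C a
      instance _ = prodFact≢0 (a ∷ ks)
      [a+s]!≡ : (a + s) ! ≡ (c * M) * (a ! * P)
      [a+s]!≡ = begin
        (a + s) !                   ≡⟨ nCk*k![n∸k]!≡n! (m≤m+n a s) ⟨
        c * (a ! * ((a + s) ∸ a) !) ≡⟨ cong (λ z → c * (a ! * z !)) (m+n∸m≡n a s) ⟩
        c * (a ! * s !)             ≡⟨ cong (λ z → c * (a ! * z)) P*M≡s! ⟨
        c * (a ! * (P * M))         ≡⟨ solve 4 (λ c x p m → c :* (x :* (p :* m)) := (c :* m) :* (x :* p)) refl c (a !) P M ⟩
        (c * M) * (a ! * P)         ∎

  prodFact*multinomial≡sum! : ∀ ks → prodFact ks * multinomial ks ≡ sum ks !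
  prodFact*multinomial≡sum! []       = refl
  prodFact*multinomial≡sum! (a ∷ ks) = begin
    (a ! * P) * multinomial (a ∷ ks) ≡⟨ cong ((a ! * P) *_) (multinomial-∷-via a ks (prodFact*multinomial≡sum! ks)) ⟩
    (a ! * P) * (c * M)              ≡⟨ solve 4 (λ x p c m → (x :* p) :* (c :* m) := c :* (x :* (p :* m))) refl (a !) P c M ⟩
    c * (a ! * (P * M))              ≡⟨ cong (λ z → c * (a ! * z)) (prodFact*multinomial≡sum! ks) ⟩
    c * (a ! * s !)                  ≡⟨ cong (λ z → c * (a ! * z !)) (m+n∸m≡n a s) ⟨
    c * (a ! * ((a + s) ∸ a) !)      ≡⟨ nCk*k![n∸k]!≡n! (m≤m+n a s) ⟩
    (a + s) !                        ∎
    where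
    s = sum ks
    P = prodFact ks
    M = multinomial ks
    c = (a + s) C a

  multinomial-∷ : ∀ a ks → multinomial (a ∷ ks) ≡ ((a + sum ks) C a) * multinomial ks
  multinomial-∷ a ks = multinomial-∷-via a ks (prodFact*multinomial≡sum! ks)

  Ascending : ℕ → List ℕ → Set
  Ascending p []       = ⊤
  Ascending p (x ∷ xs) = p < x × Ascending x xs

  ascending-last : ∀ p rs g → Ascending p (rs ++ g ∷ []) → p < g
  ascending-last p []       g (p<g , _)     = p<g
  ascending-last p (r ∷ rs) g (p<r , asc)   = <-trans p<r (ascending-last r rs g asc)

  ascending-init : ∀ p xs ys → Ascending p (xs ++ ys) → Ascending p xs
  ascending-init p []       ys _           = _
  ascending-init p (x ∷ xs) ys (p<x , asc) = p<x , ascending-init x xs ys asc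

  ascending-penultimate : ∀ p xs t g → Ascending p ((xs ++ t ∷ []) ++ g ∷ []) → t < g
  ascending-penultimate p []       t g (_ , t<g , _) = t<g
  ascending-penultimate p (x ∷ xs) t g (_ , asc)     = ascending-penultimate x xs t g asc

  private
    r∸f+g∸r≡g∸f : ∀ {f r g} → f ≤ r → r ≤ g → (r ∸ f) + (g ∸ r) ≡ g ∸ f
    r∸f+g∸r≡g∸f {f} {r} {g} f≤r r≤g = begin
      (r ∸ f) + (g ∸ r) ≡⟨ +-comm (r ∸ f) (g ∸ r) ⟩
      (g ∸ r) + (r ∸ f) ≡⟨ +-∸-assoc (g ∸ r) f≤r ⟨
      (g ∸ r) + r ∸ f   ≡⟨ cong (_∸ f) (m∸n+n≡m r≤g) ⟩
      g ∸ f             ∎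

  sum-gapsFrom : ∀ p rs g → Ascending p (rs ++ g ∷ []) → sum (gapsFrom p (rs ++ g ∷ [])) ≡ g ∸ p
  sum-gapsFrom p []       g _           = +-identityʳ (g ∸ p)
  sum-gapsFrom p (r ∷ rs) g (p<r , asc) = begin
    (r ∸ p) + sum (gapsFrom r (rs ++ g ∷ [])) ≡⟨ cong ((r ∸ p) +_) (sum-gapsFrom r rs g asc) ⟩
    (r ∸ p) + (g ∸ r)                         ≡⟨ r∸f+g∸r≡g∸f (<⇒≤ p<r) (<⇒≤ (ascending-last r rs g asc)) ⟩
    g ∸ p                                     ∎

  -- The number of chains of subsets from an f-set to a g-set whose intermediate sizes are rs.
  multinomialGaps : ℕ → List ℕ → ℕ → ℕ
  multinomialGaps f rs g = multinomial (gapsFrom f (rs ++ g ∷ []))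

  multinomialGaps-[] : ∀ f g → multinomialGaps f [] g ≡ 1
  multinomialGaps-[] f g = begin
    multinomial ((g ∸ f) ∷ [])         ≡⟨ multinomial-∷ (g ∸ f) [] ⟩
    ((g ∸ f + 0) C (g ∸ f)) * 1        ≡⟨ *-identityʳ _ ⟩
    (g ∸ f + 0) C (g ∸ f)              ≡⟨ cong (_C (g ∸ f)) (+-identityʳ (g ∸ f)) ⟩
    (g ∸ f) C (g ∸ f)                  ≡⟨ nCn≡1 (g ∸ f) ⟩
    1                                  ∎

  multinomialGaps-∷ : ∀ f r rs g → Ascending f (r ∷ rs ++ g ∷ []) →
                      multinomialGaps f (r ∷ rs) g ≡ supersets (g ∸ f) f r * multinomialGaps r rs g
  multinomialGaps-∷ f r rs g (f<r , asc) = begin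
    multinomial ((r ∸ f) ∷ gapsFrom r (rs ++ g ∷ []))
      ≡⟨ multinomial-∷ (r ∸ f) (gapsFrom r (rs ++ g ∷ [])) ⟩
    ((r ∸ f + sum (gapsFrom r (rs ++ g ∷ []))) C (r ∸ f)) * multinomialGaps r rs g
      ≡⟨ cong (λ z → ((r ∸ f + z) C (r ∸ f)) * multinomialGaps r rs g) (sum-gapsFrom r rs g asc) ⟩
    ((r ∸ f + (g ∸ r)) C (r ∸ f)) * multinomialGaps r rs g
      ≡⟨ cong (λ z → (z C (r ∸ f)) * multinomialGaps r rs g) (r∸f+g∸r≡g∸f (<⇒≤ f<r) (<⇒≤ (ascending-last r rs g asc))) ⟩
    ((g ∸ f) C (r ∸ f)) * multinomialGaps r rs g
      ≡⟨ cong (_* multinomialGaps r rs g) (supersets-≥ (g ∸ f) (<⇒≤ f<r)) ⟨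
    supersets (g ∸ f) f r * multinomialGaps r rs g ∎

  multinomialGaps-snoc : ∀ f rs t g → Ascending f ((rs ++ t ∷ []) ++ g ∷ []) →
                         multinomialGaps f (rs ++ t ∷ []) g ≡ multinomialGaps f rs t * ((g ∸ f) C (t ∸ f))
  multinomialGaps-snoc f [] t g (f<t , t<g , _) = begin
    multinomialGaps f (t ∷ []) g                          ≡⟨ multinomialGaps-∷ f t [] g (f<t , t<g , _) ⟩
    supersets (g ∸ f) f t * multinomialGaps t [] g        ≡⟨ cong₂ _*_ (supersets-≥ (g ∸ f) (<⇒≤ f<t)) (multinomialGaps-[] t g) ⟩
    ((g ∸ f) C (t ∸ f)) * 1                               ≡⟨ *-comm _ 1 ⟩
    1 * ((g ∸ f) C (t ∸ f))                               ≡⟨ cong (_* ((g ∸ f) C (t ∸ f))) (multinomialGaps-[] f t) ⟨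
    multinomialGaps f [] t * ((g ∸ f) C (t ∸ f))          ∎
  multinomialGaps-snoc f (r ∷ rs) t g (f<r , asc) = begin
    multinomialGaps f (r ∷ rs ++ t ∷ []) g
      ≡⟨ multinomialGaps-∷ f r (rs ++ t ∷ []) g (f<r , asc) ⟩
    supersets (g ∸ f) f r * multinomialGaps r (rs ++ t ∷ []) g
      ≡⟨ cong₂ _*_ (supersets-≥ (g ∸ f) f≤r) (multinomialGaps-snoc r rs t g asc) ⟩
    ((g ∸ f) C (r ∸ f)) * (multinomialGaps r rs t * ((g ∸ r) C (t ∸ r)))
      ≡⟨ solve 3 (λ a b c → a :* (b :* c) := b :* (a :* c)) refl ((g ∸ f) C (r ∸ f)) (multinomialGaps r rs t) ((g ∸ r) C (t ∸ r)) ⟩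
    multinomialGaps r rs t * (((g ∸ f) C (r ∸ f)) * ((g ∸ r) C (t ∸ r)))
      ≡⟨ cong (multinomialGaps r rs t *_) choose-twice ⟩
    multinomialGaps r rs t * (((g ∸ f) C (t ∸ f)) * ((t ∸ f) C (r ∸ f)))
      ≡⟨ solve 3 (λ a b c → a :* (b :* c) := (c :* a) :* b) refl (multinomialGaps r rs t) ((g ∸ f) C (t ∸ f)) ((t ∸ f) C (r ∸ f)) ⟩
    (((t ∸ f) C (r ∸ f)) * multinomialGaps r rs t) * ((g ∸ f) C (t ∸ f))
      ≡⟨ cong (_* ((g ∸ f) C (t ∸ f))) multinomialGaps-f-r∷rs-t ⟨
    multinomialGaps f (r ∷ rs) t * ((g ∸ f) C (t ∸ f)) ∎
    where
    f≤r = <⇒≤ f<r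
    asc-t : Ascending r (rs ++ t ∷ [])
    asc-t = ascending-init r (rs ++ t ∷ []) (g ∷ []) asc
    r<t = ascending-last r rs t asc-t
    t<g = ascending-penultimate r rs t g asc
    ∸f∸[r∸f] : ∀ x → (x ∸ f) ∸ (r ∸ f) ≡ x ∸ r
    ∸f∸[r∸f] x = trans (∸-+-assoc x f (r ∸ f)) (cong (x ∸_) (m+[n∸m]≡n f≤r))
    choose-twice : ((g ∸ f) C (r ∸ f)) * ((g ∸ r) C (t ∸ r)) ≡ ((g ∸ f) C (t ∸ f)) * ((t ∸ f) C (r ∸ f))
    choose-twice = begin
      ((g ∸ f) C (r ∸ f)) * ((g ∸ r) C (t ∸ r))
        ≡⟨ cong₂ (λ a b → ((g ∸ f) C (r ∸ f)) * (a C b)) (∸f∸[r∸f] g) (∸f∸[r∸f] t) ⟨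
      ((g ∸ f) C (r ∸ f)) * (((g ∸ f) ∸ (r ∸ f)) C ((t ∸ f) ∸ (r ∸ f)))
        ≡⟨ nCi*[n∸i]C[s∸i]≡nCs*sCi (∸-monoˡ-≤ f (<⇒≤ r<t)) (∸-monoˡ-≤ f (<⇒≤ t<g)) ⟩
      ((g ∸ f) C (t ∸ f)) * ((t ∸ f) C (r ∸ f)) ∎
    multinomialGaps-f-r∷rs-t : multinomialGaps f (r ∷ rs) t ≡ ((t ∸ f) C (r ∸ f)) * multinomialGaps r rs t
    multinomialGaps-f-r∷rs-t =
      trans (multinomialGaps-∷ f r rs t (f<r , asc-t)) (cong (_* multinomialGaps r rs t) (supersets-≥ (t ∸ f) f≤r))

module FaceChains where

  open ListSums
  open NatTests
  open Faces
  open SubsetCounts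
  open Multinomials
  open import Data.Bool using (Bool; true; false; _∧_)
  open import Data.Product using (_,_)
  open import Data.Bool.Properties using (∧-zeroʳ; ∧-identityʳ)
  open import Data.Nat using (ℕ; zero; suc; _+_; _*_; _∸_; _<_; z≤n; s≤s; _<ᵇ_; _≡ᵇ_)
  open import Data.Nat.Properties
  open import Data.List using (List; []; _∷_; map; filterᵇ; _++_)
  open import Data.Fin.Subset using (Subset; ∣_∣; ⊥)
  open import Data.Fin.Subset.Properties using (∣⊥∣≡0)
  open import Data.Vec using ([]; _∷_)
  open import Relation.Binary.PropositionalEquality
  open ≡-Reasoning

  chainsBetween : (n i : ℕ) → Elem n → Elem n → List ℕ → ℕ
  chainsBetween n i x y []       = χ (lt i x y) 1
  chainsBetween n i x y (r ∷ rs) = ∑ (filterᵇ (λ z → (rank z ≡ᵇ r) ∧ lt i x z) (cells n i)) (λ z → chainsBetween n i z y rs)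

  ∑-cells : ∀ n i (g : Elem n → ℕ) →
            ∑ (cells n i) g ≡ ∑ (allSubsets (suc n)) (λ F → χ ((0 <ᵇ ∣ F ∣) ∧ inΓ i F) (g (face F))) + g tau
  ∑-cells n i g = begin
    ∑ (map face (filterᵇ P (allSubsets (suc n))) ++ tau ∷ []) g
      ≡⟨ ∑-++ g (map face (filterᵇ P (allSubsets (suc n)))) (tau ∷ []) ⟩
    ∑ (map face (filterᵇ P (allSubsets (suc n)))) g + (g tau + 0)
      ≡⟨ cong₂ _+_ (trans (∑-map face g (filterᵇ P (allSubsets (suc n)))) (∑-filterᵇ P (λ F → g (face F)) (allSubsets (suc n))))
                   (+-identityʳ (g tau)) ⟩
    ∑ (allSubsets (suc n)) (λ F → χ (P F) (g (face F))) + g tau ∎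
    where
    P : Subset (suc n) → Bool
    P F = (0 <ᵇ ∣ F ∣) ∧ inΓ i F

  chainsBetween-tau : ∀ n i y rs → chainsBetween n i tau y rs ≡ 0
  chainsBetween-tau n i y []       = refl
  chainsBetween-tau n i y (r ∷ rs) = trans (∑-filterᵇ _ _ (cells n i))
    (∑-zero (cells n i) (λ z → cong (λ b → χ b (chainsBetween n i z y rs)) (∧-zeroʳ (rank z ≡ᵇ r))))

  chainsAbove-snoc : ∀ n i x rs r →
    chainsAbove n i x (rs ++ r ∷ []) ≡ ∑ (cells n i) (λ y → χ (rank y ≡ᵇ r) (chainsBetween n i x y rs))
  chainsAbove-snoc n i x [] r = trans (∑-filterᵇ _ (λ _ → 1) (cells n i))
    (∑-cong (cells n i) (λ y → χ-∧ (rank y ≡ᵇ r) (lt i x y) 1))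
  chainsAbove-snoc n i x (r′ ∷ rs) r = begin
    ∑ (filterᵇ P (cells n i)) (λ z → chainsAbove n i z (rs ++ r ∷ []))
      ≡⟨ ∑-filterᵇ P _ (cells n i) ⟩
    ∑ (cells n i) (λ z → χ (P z) (chainsAbove n i z (rs ++ r ∷ [])))
      ≡⟨ ∑-cong (cells n i) (λ z → trans (cong (χ (P z)) (chainsAbove-snoc n i z rs r)) (χ-∑ (P z) (cells n i) _)) ⟩
    ∑ (cells n i) (λ z → ∑ (cells n i) (λ y → χ (P z) (χ (rank y ≡ᵇ r) (chainsBetween n i z y rs))))
      ≡⟨ ∑-comm (λ z y → χ (P z) (χ (rank y ≡ᵇ r) (chainsBetween n i z y rs))) (cells n i) (cells n i) ⟩
    ∑ (cells n i) (λ y → ∑ (cells n i) (λ z → χ (P z) (χ (rank y ≡ᵇ r) (chainsBetween n i z y rs))))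
      ≡⟨ ∑-cong (cells n i) pull-out ⟩
    ∑ (cells n i) (λ y → χ (rank y ≡ᵇ r) (chainsBetween n i x y (r′ ∷ rs))) ∎
    where
    P : Elem n → Bool
    P z = (rank z ≡ᵇ r′) ∧ lt i x z
    pull-out : ∀ y → ∑ (cells n i) (λ z → χ (P z) (χ (rank y ≡ᵇ r) (chainsBetween n i z y rs)))
                     ≡ χ (rank y ≡ᵇ r) (chainsBetween n i x y (r′ ∷ rs))
    pull-out y = begin
      ∑ (cells n i) (λ z → χ (P z) (χ (rank y ≡ᵇ r) (chainsBetween n i z y rs)))
        ≡⟨ ∑-cong (cells n i) (λ z → χ-comm (P z) (rank y ≡ᵇ r) _) ⟩
      ∑ (cells n i) (λ z → χ (rank y ≡ᵇ r) (χ (P z) (chainsBetween n i z y rs)))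
        ≡⟨ χ-∑ (rank y ≡ᵇ r) (cells n i) _ ⟨
      χ (rank y ≡ᵇ r) (∑ (cells n i) (λ z → χ (P z) (chainsBetween n i z y rs)))
        ≡⟨ cong (χ (rank y ≡ᵇ r)) (∑-filterᵇ P _ (cells n i)) ⟨
      χ (rank y ≡ᵇ r) (chainsBetween n i x y (r′ ∷ rs)) ∎

  chainsBetween-snoc : ∀ n i x y rs t →
    chainsBetween n i x y (rs ++ t ∷ []) ≡ ∑ (cells n i) (λ z → χ (rank z ≡ᵇ t) (chainsBetween n i x z rs * χ (lt i z y) 1))
  chainsBetween-snoc n i x y [] t = trans (∑-filterᵇ _ _ (cells n i)) (∑-cong (cells n i) (λ z →
    trans (χ-∧ (rank z ≡ᵇ t) (lt i x z) _) (cong (χ (rank z ≡ᵇ t)) (sym (χ-1-* (lt i x z) _)))))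
  chainsBetween-snoc n i x y (r′ ∷ rs) t = begin
    ∑ (filterᵇ P (cells n i)) (λ w → chainsBetween n i w y (rs ++ t ∷ []))
      ≡⟨ ∑-filterᵇ P _ (cells n i) ⟩
    ∑ (cells n i) (λ w → χ (P w) (chainsBetween n i w y (rs ++ t ∷ [])))
      ≡⟨ ∑-cong (cells n i) (λ w → trans (cong (χ (P w)) (chainsBetween-snoc n i w y rs t)) (χ-∑ (P w) (cells n i) _)) ⟩
    ∑ (cells n i) (λ w → ∑ (cells n i) (λ z → χ (P w) (χ (rank z ≡ᵇ t) (chainsBetween n i w z rs * χ (lt i z y) 1))))
      ≡⟨ ∑-comm (λ w z → χ (P w) (χ (rank z ≡ᵇ t) (chainsBetween n i w z rs * χ (lt i z y) 1))) (cells n i) (cells n i) ⟩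
    ∑ (cells n i) (λ z → ∑ (cells n i) (λ w → χ (P w) (χ (rank z ≡ᵇ t) (chainsBetween n i w z rs * χ (lt i z y) 1))))
      ≡⟨ ∑-cong (cells n i) pull-out ⟩
    ∑ (cells n i) (λ z → χ (rank z ≡ᵇ t) (chainsBetween n i x z (r′ ∷ rs) * χ (lt i z y) 1)) ∎
    where
    P : Elem n → Bool
    P z = (rank z ≡ᵇ r′) ∧ lt i x z
    pull-out : ∀ z → ∑ (cells n i) (λ w → χ (P w) (χ (rank z ≡ᵇ t) (chainsBetween n i w z rs * χ (lt i z y) 1)))
                     ≡ χ (rank z ≡ᵇ t) (chainsBetween n i x z (r′ ∷ rs) * χ (lt i z y) 1)
    pull-out z = begin
      ∑ (cells n i) (λ w → χ (P w) (χ (rank z ≡ᵇ t) (chainsBetween n i w z rs * c)))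
        ≡⟨ ∑-cong (cells n i) (λ w → trans (χ-comm (P w) (rank z ≡ᵇ t) _) (cong (χ (rank z ≡ᵇ t)) (sym (χ-*ʳ (P w) _ c)))) ⟩
      ∑ (cells n i) (λ w → χ (rank z ≡ᵇ t) (χ (P w) (chainsBetween n i w z rs) * c))
        ≡⟨ χ-∑ (rank z ≡ᵇ t) (cells n i) _ ⟨
      χ (rank z ≡ᵇ t) (∑ (cells n i) (λ w → χ (P w) (chainsBetween n i w z rs) * c))
        ≡⟨ cong (χ (rank z ≡ᵇ t)) (∑-*ʳ _ c (cells n i)) ⟨
      χ (rank z ≡ᵇ t) (∑ (cells n i) (λ w → χ (P w) (chainsBetween n i w z rs)) * c)
        ≡⟨ cong (λ v → χ (rank z ≡ᵇ t) (v * c)) (∑-filterᵇ P _ (cells n i)) ⟨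
      χ (rank z ≡ᵇ t) (chainsBetween n i x z (r′ ∷ rs) * c) ∎
      where c = χ (lt i z y) 1

  missesUpTo-⊆ᵇ : ∀ {m} i (F G : Subset m) → F ⊆ᵇ G ≡ true → missesUpTo i G ≡ true → missesUpTo i F ≡ true
  missesUpTo-⊆ᵇ i       []          []          _   ()
  missesUpTo-⊆ᵇ zero    (false ∷ F) (false ∷ G) _   _   = refl
  missesUpTo-⊆ᵇ (suc i) (false ∷ F) (y ∷ G)     _   _   = refl
  missesUpTo-⊆ᵇ (suc i) (true ∷ F)  (true ∷ G)  F⊆G inG = missesUpTo-⊆ᵇ i F G F⊆G inG
  missesUpTo-⊆ᵇ zero    (true ∷ F)  (false ∷ G) ()  _
  missesUpTo-⊆ᵇ zero    (x ∷ F)     (true ∷ G)  _   ()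
  missesUpTo-⊆ᵇ (suc i) (true ∷ F)  (false ∷ G) ()  _

  ⊥⊆ᵇ : ∀ {m} (F : Subset m) → ⊥ ⊆ᵇ F ≡ true
  ⊥⊆ᵇ []      = refl
  ⊥⊆ᵇ (x ∷ F) = ⊥⊆ᵇ F

  ⊥-missesAbove : ∀ {m} i → i < m → missesAbove i (⊥ {suc m}) ≡ true
  ⊥-missesAbove {suc m} zero    _         = refl
  ⊥-missesAbove {suc m} (suc i) (s≤s i<m) = ⊥-missesAbove i i<m

  ⊥-missesUpTo : ∀ {m} i → missesUpTo i (⊥ {suc m}) ≡ true
  ⊥-missesUpTo zero    = refl
  ⊥-missesUpTo (suc i) = refl

  ⊥-inBoundary : ∀ {n} i → i < n → inBoundary i (⊥ {suc n}) ≡ true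
  ⊥-inBoundary i i<n = trans (inBoundary≡inBoundaryOf i ⊥) (cong₂ _∧_ (⊥-missesUpTo i) (⊥-missesAbove i i<n))

  -- Every face below a face of Γⁿᵢ lies in Γⁿᵢ, so these chains are chains of subsets.
  chainsBetween-faces : ∀ n i (F G : Subset (suc n)) rs → missesUpTo i G ≡ true → Ascending ∣ F ∣ (rs ++ ∣ G ∣ ∷ []) →
    chainsBetween n i (face F) (face G) rs ≡ χ (F ⊆ᵇ G) (multinomialGaps (∣ F ∣) rs (∣ G ∣))
  chainsBetween-faces n i F G [] _ (∣F∣<∣G∣ , _) = begin
    χ (subsetᵇ F G ∧ (∣ F ∣ <ᵇ ∣ G ∣)) 1
      ≡⟨ cong₂ (λ a b → χ (a ∧ b) 1) (subsetᵇ≡⊆ᵇ F G) (<⇒<ᵇ-true ∣F∣<∣G∣) ⟩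
    χ (F ⊆ᵇ G ∧ true) 1
      ≡⟨ cong (λ a → χ a 1) (∧-identityʳ (F ⊆ᵇ G)) ⟩
    χ (F ⊆ᵇ G) 1
      ≡⟨ cong (χ (F ⊆ᵇ G)) (multinomialGaps-[] (∣ F ∣) (∣ G ∣)) ⟨
    χ (F ⊆ᵇ G) (multinomialGaps (∣ F ∣) [] (∣ G ∣)) ∎
  chainsBetween-faces n i F G (r ∷ rs) G∈Γ (∣F∣<r , asc) = begin
    ∑ (filterᵇ P (cells n i)) (λ z → chainsBetween n i z (face G) rs)
      ≡⟨ ∑-filterᵇ P _ (cells n i) ⟩
    ∑ (cells n i) (λ z → χ (P z) (chainsBetween n i z (face G) rs))
      ≡⟨ ∑-cells n i _ ⟩
    ∑ (allSubsets (suc n)) (λ H → χ ((0 <ᵇ ∣ H ∣) ∧ inΓ i H) (χ (P (face H)) (chainsBetween n i (face H) (face G) rs)))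
      + χ (P tau) (chainsBetween n i tau (face G) rs)
      ≡⟨ cong₂ _+_ (∑-cong (allSubsets (suc n)) per-face)
                   (trans (cong (χ (P tau)) (chainsBetween-tau n i (face G) rs)) (χ-zero (P tau))) ⟩
    ∑ (allSubsets (suc n)) (λ H → χ (inInterval F G H) (χ (∣ H ∣ ≡ᵇ r) 1) * M) + 0
      ≡⟨ +-identityʳ _ ⟩
    ∑ (allSubsets (suc n)) (λ H → χ (inInterval F G H) (χ (∣ H ∣ ≡ᵇ r) 1) * M)
      ≡⟨ ∑-*ʳ _ M (allSubsets (suc n)) ⟨
    count (suc n) (inInterval F G) r * M
      ≡⟨ cong (_* M) (count-interval F G r) ⟩
    χ (F ⊆ᵇ G) (supersets (∣ G ∣ ∸ ∣ F ∣) ∣ F ∣ r) * M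
      ≡⟨ χ-*ʳ (F ⊆ᵇ G) _ M ⟩
    χ (F ⊆ᵇ G) (supersets (∣ G ∣ ∸ ∣ F ∣) ∣ F ∣ r * M)
      ≡⟨ cong (χ (F ⊆ᵇ G)) (multinomialGaps-∷ (∣ F ∣) r rs (∣ G ∣) (∣F∣<r , asc)) ⟨
    χ (F ⊆ᵇ G) (multinomialGaps (∣ F ∣) (r ∷ rs) (∣ G ∣)) ∎
    where
    M = multinomialGaps r rs (∣ G ∣)
    P : Elem n → Bool
    P z = (rank z ≡ᵇ r) ∧ lt i (face F) z
    per-face : ∀ H → χ ((0 <ᵇ ∣ H ∣) ∧ inΓ i H) (χ (P (face H)) (chainsBetween n i (face H) (face G) rs))
                     ≡ χ (inInterval F G H) (χ (∣ H ∣ ≡ᵇ r) 1) * M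
    per-face H with ∣ H ∣ ≡ᵇ r in ∣H∣≡ᵇr
    ... | false = trans (χ-zero _) (sym (cong (_* M) (χ-zero (inInterval F G H))))
    ... | true  = begin
      χ ((0 <ᵇ ∣ H ∣) ∧ inΓ i H) (χ (subsetᵇ F H ∧ (∣ F ∣ <ᵇ ∣ H ∣)) chains)
        ≡⟨ cong₂ (λ a b → χ (a ∧ inΓ i H) (χ (subsetᵇ F H ∧ b) chains))
                 (<⇒<ᵇ-true (≤-<-trans z≤n ∣F∣<∣H∣)) (<⇒<ᵇ-true ∣F∣<∣H∣) ⟩
      χ (inΓ i H) (χ (subsetᵇ F H ∧ true) chains)
        ≡⟨ cong₂ (λ a b → χ a (χ b chains)) (inΓ≡missesUpTo i H) (trans (∧-identityʳ _) (subsetᵇ≡⊆ᵇ F H)) ⟩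
      χ (missesUpTo i H) (χ (F ⊆ᵇ H) chains)
        ≡⟨ cong (λ v → χ (missesUpTo i H) (χ (F ⊆ᵇ H) v)) (chainsBetween-faces n i H G rs G∈Γ asc-H) ⟩
      χ (missesUpTo i H) (χ (F ⊆ᵇ H) (χ (H ⊆ᵇ G) (multinomialGaps (∣ H ∣) rs (∣ G ∣))))
        ≡⟨ drop-Γ (H ⊆ᵇ G) refl ⟩
      χ (F ⊆ᵇ H) (χ (H ⊆ᵇ G) 1) * M
        ≡⟨ cong (_* M) (χ-∧ (F ⊆ᵇ H) (H ⊆ᵇ G) 1) ⟨
      χ (inInterval F G H) 1 * M ∎
      where
      chains = chainsBetween n i (face H) (face G) rs
      ∣H∣≡r : ∣ H ∣ ≡ r
      ∣H∣≡r = ≡ᵇ-true⇒≡ ∣ H ∣ r ∣H∣≡ᵇr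
      ∣F∣<∣H∣ : ∣ F ∣ < ∣ H ∣
      ∣F∣<∣H∣ = subst (∣ F ∣ <_) (sym ∣H∣≡r) ∣F∣<r
      asc-H : Ascending ∣ H ∣ (rs ++ ∣ G ∣ ∷ [])
      asc-H = subst (λ z → Ascending z (rs ++ ∣ G ∣ ∷ [])) (sym ∣H∣≡r) asc
      drop-Γ : ∀ b → H ⊆ᵇ G ≡ b →
               χ (missesUpTo i H) (χ (F ⊆ᵇ H) (χ b (multinomialGaps (∣ H ∣) rs (∣ G ∣)))) ≡ χ (F ⊆ᵇ H) (χ b 1) * M
      drop-Γ false _   = trans (cong (χ (missesUpTo i H)) (χ-zero (F ⊆ᵇ H))) (trans (χ-zero _) (sym (cong (_* M) (χ-zero (F ⊆ᵇ H)))))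
      drop-Γ true  H⊆G = begin
        χ (missesUpTo i H) (χ (F ⊆ᵇ H) (multinomialGaps (∣ H ∣) rs (∣ G ∣)))
          ≡⟨ cong (λ a → χ a (χ (F ⊆ᵇ H) (multinomialGaps (∣ H ∣) rs (∣ G ∣)))) (missesUpTo-⊆ᵇ i H G H⊆G G∈Γ) ⟩
        χ (F ⊆ᵇ H) (multinomialGaps (∣ H ∣) rs (∣ G ∣))
          ≡⟨ cong (λ z → χ (F ⊆ᵇ H) (multinomialGaps z rs (∣ G ∣))) ∣H∣≡r ⟩
        χ (F ⊆ᵇ H) M
          ≡⟨ χ-1-* (F ⊆ᵇ H) M ⟨
        χ (F ⊆ᵇ H) 1 * M ∎

  -- ⊥ is not a cell, but above 0̂ it behaves like 0̂: it lies below every face, and below τ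
  -- because ⊥ lies in ∂Γⁿᵢ.
  chainsBetween-bot : ∀ n i → i < n → ∀ y r rs → chainsBetween n i bot y (r ∷ rs) ≡ chainsBetween n i (face ⊥) y (r ∷ rs)
  chainsBetween-bot n i i<n y r rs = begin
    ∑ (filterᵇ (above bot) (cells n i)) (λ z → chainsBetween n i z y rs)
      ≡⟨ ∑-filterᵇ (above bot) _ (cells n i) ⟩
    ∑ (cells n i) (λ z → χ (above bot z) (chainsBetween n i z y rs))
      ≡⟨ ∑-cells n i _ ⟩
    ∑ (allSubsets (suc n)) (λ F → χ ((0 <ᵇ ∣ F ∣) ∧ inΓ i F) (χ (above bot (face F)) (chainsBetween n i (face F) y rs)))
      + χ (above bot tau) (chainsBetween n i tau y rs)
      ≡⟨ cong₂ _+_ (∑-cong (allSubsets (suc n)) per-face)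
                   (cong (λ b → χ ((n ≡ᵇ r) ∧ b) (chainsBetween n i tau y rs)) (⊥-inBoundary i i<n)) ⟨
    ∑ (allSubsets (suc n)) (λ F → χ ((0 <ᵇ ∣ F ∣) ∧ inΓ i F) (χ (above (face ⊥) (face F)) (chainsBetween n i (face F) y rs)))
      + χ (above (face ⊥) tau) (chainsBetween n i tau y rs)
      ≡⟨ ∑-cells n i _ ⟨
    ∑ (cells n i) (λ z → χ (above (face ⊥) z) (chainsBetween n i z y rs))
      ≡⟨ ∑-filterᵇ (above (face ⊥)) _ (cells n i) ⟨
    ∑ (filterᵇ (above (face ⊥)) (cells n i)) (λ z → chainsBetween n i z y rs) ∎
    where
    above : Elem n → Elem n → Bool
    above x z = (rank z ≡ᵇ r) ∧ lt i x z
    per-face : ∀ F → χ ((0 <ᵇ ∣ F ∣) ∧ inΓ i F) (χ (above (face ⊥) (face F)) (chainsBetween n i (face F) y rs))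
                     ≡ χ ((0 <ᵇ ∣ F ∣) ∧ inΓ i F) (χ (above bot (face F)) (chainsBetween n i (face F) y rs))
    per-face F with 0 <ᵇ ∣ F ∣ in 0<ᵇ∣F∣
    ... | false = refl
    ... | true  = cong (λ b → χ (inΓ i F) (χ ((∣ F ∣ ≡ᵇ r) ∧ b) (chainsBetween n i (face F) y rs)))
                       (trans (cong₂ (λ a b → a ∧ (b <ᵇ ∣ F ∣)) ⊥⊆F (∣⊥∣≡0 (suc n))) 0<ᵇ∣F∣)
      where ⊥⊆F = trans (subsetᵇ≡⊆ᵇ ⊥ F) (⊥⊆ᵇ F)

  chainsBetween-bot-face : ∀ n i → i < n → ∀ (G : Subset (suc n)) rs → missesUpTo i G ≡ true →
    Ascending 0 (rs ++ ∣ G ∣ ∷ []) → chainsBetween n i bot (face G) rs ≡ multinomialGaps 0 rs (∣ G ∣)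
  chainsBetween-bot-face n i i<n G []       G∈Γ asc = sym (multinomialGaps-[] 0 (∣ G ∣))
  chainsBetween-bot-face n i i<n G (r ∷ rs) G∈Γ asc = begin
    chainsBetween n i bot (face G) (r ∷ rs)
      ≡⟨ chainsBetween-bot n i i<n (face G) r rs ⟩
    chainsBetween n i (face ⊥) (face G) (r ∷ rs)
      ≡⟨ chainsBetween-faces n i ⊥ G (r ∷ rs) G∈Γ
                             (subst (λ z → Ascending z (r ∷ rs ++ ∣ G ∣ ∷ [])) (sym (∣⊥∣≡0 (suc n))) asc) ⟩
    χ (⊥ ⊆ᵇ G) (multinomialGaps (∣ ⊥ {suc n} ∣) (r ∷ rs) (∣ G ∣))
      ≡⟨ cong₂ (λ a b → χ a (multinomialGaps b (r ∷ rs) (∣ G ∣))) (⊥⊆ᵇ G) (∣⊥∣≡0 (suc n)) ⟩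
    multinomialGaps 0 (r ∷ rs) (∣ G ∣) ∎

  chainsAbove-bot : ∀ n i → i < n → ∀ rs s → Ascending 0 (rs ++ s ∷ []) →
    chainsAbove n i bot (rs ++ s ∷ [])
      ≡ count (suc n) (missesUpTo i) s * multinomialGaps 0 rs s + χ (n ≡ᵇ s) (chainsBetween n i bot tau rs)
  chainsAbove-bot n i i<n rs s asc = begin
    chainsAbove n i bot (rs ++ s ∷ [])
      ≡⟨ chainsAbove-snoc n i bot rs s ⟩
    ∑ (cells n i) (λ y → χ (rank y ≡ᵇ s) (chainsBetween n i bot y rs))
      ≡⟨ ∑-cells n i _ ⟩
    ∑ (allSubsets (suc n)) (λ F → χ ((0 <ᵇ ∣ F ∣) ∧ inΓ i F) (χ (∣ F ∣ ≡ᵇ s) (chainsBetween n i bot (face F) rs)))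
      + τ-chains
      ≡⟨ cong (_+ τ-chains) (trans (∑-cong (allSubsets (suc n)) per-face) (sym (∑-*ʳ _ M (allSubsets (suc n))))) ⟩
    count (suc n) (missesUpTo i) s * M + τ-chains ∎
    where
    M = multinomialGaps 0 rs s
    τ-chains = χ (n ≡ᵇ s) (chainsBetween n i bot tau rs)
    per-face : ∀ F → χ ((0 <ᵇ ∣ F ∣) ∧ inΓ i F) (χ (∣ F ∣ ≡ᵇ s) (chainsBetween n i bot (face F) rs))
                     ≡ χ (missesUpTo i F) (χ (∣ F ∣ ≡ᵇ s) 1) * M
    per-face F with ∣ F ∣ ≡ᵇ s in ∣F∣≡ᵇs
    ... | false = trans (χ-zero _) (sym (cong (_* M) (χ-zero (missesUpTo i F))))
    ... | true  = trans (cong₂ (λ a b → χ (a ∧ b) (chainsBetween n i bot (face F) rs))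
                               (<⇒<ᵇ-true (subst (0 <_) (sym ∣F∣≡s) (ascending-last 0 rs s asc))) (inΓ≡missesUpTo i F))
                        (faces-in-Γ (missesUpTo i F) refl)
      where
      ∣F∣≡s = ≡ᵇ-true⇒≡ ∣ F ∣ s ∣F∣≡ᵇs
      faces-in-Γ : ∀ b → missesUpTo i F ≡ b → χ b (chainsBetween n i bot (face F) rs) ≡ χ b 1 * M
      faces-in-Γ false _   = refl
      faces-in-Γ true  F∈Γ = begin
        chainsBetween n i bot (face F) rs
          ≡⟨ chainsBetween-bot-face n i i<n F rs F∈Γ (subst (λ z → Ascending 0 (rs ++ z ∷ [])) (sym ∣F∣≡s) asc) ⟩
        multinomialGaps 0 rs (∣ F ∣)
          ≡⟨ cong (multinomialGaps 0 rs) ∣F∣≡s ⟩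
        M
          ≡⟨ +-identityʳ M ⟨
        1 * M ∎

  chainsBetween-bot-tau : ∀ n i → i < n → ∀ rs t → Ascending 0 (rs ++ t ∷ []) →
    chainsBetween n i bot tau (rs ++ t ∷ []) ≡ count (suc n) (inBoundaryOf i) t * multinomialGaps 0 rs t
  chainsBetween-bot-tau n i i<n rs t asc = begin
    chainsBetween n i bot tau (rs ++ t ∷ [])
      ≡⟨ chainsBetween-snoc n i bot tau rs t ⟩
    ∑ (cells n i) (λ z → χ (rank z ≡ᵇ t) (chainsBetween n i bot z rs * χ (lt i z tau) 1))
      ≡⟨ ∑-cells n i _ ⟩
    ∑ (allSubsets (suc n))
      (λ F → χ ((0 <ᵇ ∣ F ∣) ∧ inΓ i F) (χ (∣ F ∣ ≡ᵇ t) (chainsBetween n i bot (face F) rs * χ (inBoundary i F) 1)))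
      + χ (n ≡ᵇ t) (chainsBetween n i bot tau rs * 0)
      ≡⟨ cong₂ _+_ (trans (∑-cong (allSubsets (suc n)) per-face) (sym (∑-*ʳ _ M (allSubsets (suc n)))))
                   (trans (cong (χ (n ≡ᵇ t)) (*-zeroʳ (chainsBetween n i bot tau rs))) (χ-zero (n ≡ᵇ t))) ⟩
    count (suc n) (inBoundaryOf i) t * M + 0
      ≡⟨ +-identityʳ _ ⟩
    count (suc n) (inBoundaryOf i) t * M ∎
    where
    M = multinomialGaps 0 rs t
    per-face : ∀ F → χ ((0 <ᵇ ∣ F ∣) ∧ inΓ i F) (χ (∣ F ∣ ≡ᵇ t) (chainsBetween n i bot (face F) rs * χ (inBoundary i F) 1))
                     ≡ χ (inBoundaryOf i F) (χ (∣ F ∣ ≡ᵇ t) 1) * M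
    per-face F with ∣ F ∣ ≡ᵇ t in ∣F∣≡ᵇt
    ... | false = trans (χ-zero _) (sym (cong (_* M) (χ-zero (inBoundaryOf i F))))
    ... | true  = trans (cong₃ (<⇒<ᵇ-true (subst (0 <_) (sym ∣F∣≡t) (ascending-last 0 rs t asc)))
                               (inΓ≡missesUpTo i F) (inBoundary≡inBoundaryOf i F))
                        (faces-in-Γ (missesUpTo i F) refl)
      where
      ∣F∣≡t = ≡ᵇ-true⇒≡ ∣ F ∣ t ∣F∣≡ᵇt
      chains = chainsBetween n i bot (face F) rs
      cong₃ : ∀ {a a′ b b′ c c′} → a ≡ a′ → b ≡ b′ → c ≡ c′ →
              χ (a ∧ b) (chains * χ c 1) ≡ χ (a′ ∧ b′) (chains * χ c′ 1)
      cong₃ refl refl refl = refl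
      faces-in-Γ : ∀ b → missesUpTo i F ≡ b → χ (true ∧ b) (chains * χ (b ∧ missesAbove i F) 1) ≡ χ (b ∧ missesAbove i F) 1 * M
      faces-in-Γ false _   = refl
      faces-in-Γ true  F∈Γ = begin
        chains * χ (missesAbove i F) 1
          ≡⟨ cong (_* χ (missesAbove i F) 1)
                  (chainsBetween-bot-face n i i<n F rs F∈Γ (subst (λ z → Ascending 0 (rs ++ z ∷ [])) (sym ∣F∣≡t) asc)) ⟩
        multinomialGaps 0 rs (∣ F ∣) * χ (missesAbove i F) 1
          ≡⟨ cong (λ z → multinomialGaps 0 rs z * χ (missesAbove i F) 1) ∣F∣≡t ⟩
        M * χ (missesAbove i F) 1
          ≡⟨ *-comm M _ ⟩
        χ (missesAbove i F) 1 * M ∎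

module AlternatingSums where

  open import Data.Nat as ℕ using (ℕ; zero; suc; _∸_; _≤_; _<_; z≤n; s≤s)
  import Data.Nat.Properties as ℕ
  open import Data.Nat.Combinatorics using (_C_; nCk+nC[k+1]≡[n+1]C[k+1]; k>n⇒nCk≡0)
  open import Data.Integer using (ℤ; +_; -_; _+_; _*_; _-_; -1ℤ)
  open import Data.Integer.Properties
  open import Data.Integer.Solver using (module +-*-Solver)
  open import Data.List using (map; foldr; applyUpTo)
  open import Algebra.Properties.CommutativeSemigroup +-commutativeSemigroup using (interchange)
  open import Relation.Binary.PropositionalEquality
  open ≡-Reasoning
  open +-*-Solver using (solve; _:+_; _:*_; :-_; _:-_; _:=_; con)

  ∑< : ℕ → (ℕ → ℤ) → ℤ
  ∑< zero    f = + 0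
  ∑< (suc k) f = f 0 + ∑< k (λ j → f (suc j))

  sumRange≡∑< : ∀ a b f → sumRange a b f ≡ ∑< (suc b ∸ a) (λ j → f (a ℕ.+ j))
  sumRange≡∑< a b f = go (λ j → j) (suc b ∸ a)
    where
    go : ∀ g k → foldr (λ i acc → f i + acc) (+ 0) (map (a ℕ.+_) (applyUpTo g k)) ≡ ∑< k (λ j → f (a ℕ.+ g j))
    go g zero    = refl
    go g (suc k) = cong (_+_ (f (a ℕ.+ g 0))) (go (λ j → g (suc j)) k)

  ∑<-cong : ∀ k {f g : ℕ → ℤ} → (∀ j → j < k → f j ≡ g j) → ∑< k f ≡ ∑< k g
  ∑<-cong zero    f≗g = refl
  ∑<-cong (suc k) f≗g = cong₂ _+_ (f≗g 0 (s≤s z≤n)) (∑<-cong k (λ j j<k → f≗g (suc j) (s≤s j<k)))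

  ∑<-zero : ∀ k {f : ℕ → ℤ} → (∀ j → j < k → f j ≡ + 0) → ∑< k f ≡ + 0
  ∑<-zero zero    f≗0 = refl
  ∑<-zero (suc k) f≗0 = cong₂ _+_ (f≗0 0 (s≤s z≤n)) (∑<-zero k (λ j j<k → f≗0 (suc j) (s≤s j<k)))

  ∑<-snoc : ∀ k f → ∑< (suc k) f ≡ ∑< k f + f k
  ∑<-snoc zero    f = trans (+-identityʳ (f 0)) (sym (+-identityˡ (f 0)))
  ∑<-snoc (suc k) f = trans (cong (_+_ (f 0)) (∑<-snoc k (λ j → f (suc j)))) (sym (+-assoc (f 0) _ _))

  ∑<-distrib-+ : ∀ k f g → ∑< k (λ j → f j + g j) ≡ ∑< k f + ∑< k g
  ∑<-distrib-+ zero    f g = refl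
  ∑<-distrib-+ (suc k) f g = trans (cong (_+_ (f 0 + g 0)) (∑<-distrib-+ k _ _)) (interchange (f 0) (g 0) _ _)

  ∑<-*ˡ : ∀ k c f → ∑< k (λ j → c * f j) ≡ c * ∑< k f
  ∑<-*ˡ zero    c f = sym (*-zeroʳ c)
  ∑<-*ˡ (suc k) c f = trans (cong (_+_ (c * f 0)) (∑<-*ˡ k c _)) (sym (*-distribˡ-+ c (f 0) _))

  ∑<-split : ∀ a b f → ∑< (a ℕ.+ b) f ≡ ∑< a f + ∑< b (λ j → f (a ℕ.+ j))
  ∑<-split zero    b f = sym (+-identityˡ _)
  ∑<-split (suc a) b f = trans (cong (_+_ (f 0)) (∑<-split a b (λ j → f (suc j)))) (sym (+-assoc (f 0) _ _))

  ∑<-reverse : ∀ k f → ∑< k (λ j → f (k ∸ suc j)) ≡ ∑< k f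
  ∑<-reverse zero    f = refl
  ∑<-reverse (suc k) f = begin
    f k + ∑< k (λ j → f (k ∸ suc j)) ≡⟨ cong (_+_ (f k)) (∑<-reverse k f) ⟩
    f k + ∑< k f                     ≡⟨ +-comm (f k) _ ⟩
    ∑< k f + f k                     ≡⟨ ∑<-snoc k f ⟨
    ∑< (suc k) f                     ∎

  ∑<-truncate : ∀ {c k} f → c ≤ k → (∀ j → c ≤ j → f j ≡ + 0) → ∑< k f ≡ ∑< c f
  ∑<-truncate {c} {k} f c≤k f≗0 = begin
    ∑< k f                                       ≡⟨ cong (λ l → ∑< l f) (ℕ.m+[n∸m]≡n c≤k) ⟨
    ∑< (c ℕ.+ (k ∸ c)) f                         ≡⟨ ∑<-split c (k ∸ c) f ⟩
    ∑< c f + ∑< (k ∸ c) (λ j → f (c ℕ.+ j))      ≡⟨ cong (_+_ (∑< c f)) (∑<-zero (k ∸ c) (λ j _ → f≗0 _ (ℕ.m≤m+n c j))) ⟩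
    ∑< c f + + 0                                 ≡⟨ +-identityʳ _ ⟩
    ∑< c f                                       ∎

  sgn-suc : ∀ i → sgn (suc i) ≡ - sgn i
  sgn-suc i = -1*i≡-i (sgn i)

  sgn-even : ∀ j → sgn (j ℕ.+ j) ≡ + 1
  sgn-even zero    = refl
  sgn-even (suc j) = begin
    sgn (suc j ℕ.+ suc j)          ≡⟨ cong (λ k → sgn (suc k)) (ℕ.+-suc j j) ⟩
    -1ℤ * (-1ℤ * sgn (j ℕ.+ j))    ≡⟨ cong (λ z → -1ℤ * (-1ℤ * z)) (sgn-even j) ⟩
    + 1                            ∎

  sgn-odd : ∀ q → sgn (suc (q ℕ.+ q)) ≡ -1ℤ
  sgn-odd q = trans (sgn-suc (q ℕ.+ q)) (cong -_ (sgn-even q))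

  sgn-reflect : ∀ q j → j ≤ q → sgn (suc q ℕ.+ j) ≡ - sgn (q ∸ j)
  sgn-reflect q j j≤q = begin
    sgn (suc q ℕ.+ j)                        ≡⟨ cong sgn q∸j+[1+2j]≡1+q+j ⟨
    sgn ((q ∸ j) ℕ.+ suc (j ℕ.+ j))          ≡⟨ ^-distribˡ-+-* -1ℤ (q ∸ j) (suc (j ℕ.+ j)) ⟩
    sgn (q ∸ j) * sgn (suc (j ℕ.+ j))        ≡⟨ cong (sgn (q ∸ j) *_) (sgn-odd j) ⟩
    sgn (q ∸ j) * -1ℤ                        ≡⟨ solve 1 (λ s → s :* :- con (+ 1) := :- s) refl (sgn (q ∸ j)) ⟩
    - sgn (q ∸ j)                            ∎
    where
    q∸j+[1+2j]≡1+q+j : (q ∸ j) ℕ.+ suc (j ℕ.+ j) ≡ suc q ℕ.+ j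
    q∸j+[1+2j]≡1+q+j = begin
      (q ∸ j) ℕ.+ suc (j ℕ.+ j)   ≡⟨ ℕ.+-suc (q ∸ j) (j ℕ.+ j) ⟩
      suc ((q ∸ j) ℕ.+ (j ℕ.+ j)) ≡⟨ cong suc (ℕ.+-assoc (q ∸ j) j j) ⟨
      suc ((q ∸ j) ℕ.+ j ℕ.+ j)   ≡⟨ cong (λ z → suc (z ℕ.+ j)) (ℕ.m∸n+n≡m j≤q) ⟩
      suc q ℕ.+ j                 ∎

  alternating-partial-sum : ∀ t k → ∑< (suc k) (λ i → sgn i * + (suc t C i)) ≡ sgn k * + (t C k)
  alternating-partial-sum t zero    = refl
  alternating-partial-sum t (suc k) = begin
    ∑< (suc (suc k)) g
      ≡⟨ ∑<-snoc (suc k) g ⟩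
    ∑< (suc k) g + g (suc k)
      ≡⟨ cong (_+ g (suc k)) (alternating-partial-sum t k) ⟩
    sgn k * + (t C k) + sgn (suc k) * + (suc t C suc k)
      ≡⟨ cong₂ (λ a b → sgn k * + (t C k) + a * b) (sgn-suc k)
               (trans (cong +_ (sym (nCk+nC[k+1]≡[n+1]C[k+1] t k))) (pos-+ (t C k) (t C suc k))) ⟩
    sgn k * + (t C k) + - sgn k * (+ (t C k) + + (t C suc k))
      ≡⟨ solve 3 (λ s a b → s :* a :+ (:- s) :* (a :+ b) := (:- s) :* b) refl (sgn k) (+ (t C k)) (+ (t C suc k)) ⟩
    - sgn k * + (t C suc k)
      ≡⟨ cong (_* + (t C suc k)) (sgn-suc k) ⟨
    sgn (suc k) * + (t C suc k) ∎
    where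
    g : ℕ → ℤ
    g i = sgn i * + (suc t C i)

  -- Reflecting k = 2q + 1 − i turns the sum into ∑_{1 ≤ k ≤ 2q} (−1)ᵏ C(t, k), which is −1
  -- for 1 ≤ t ≤ 2q.
  alternating-reflected-sum : ∀ q t → 1 ≤ t → t ≤ q ℕ.+ q →
    ∑< q (λ j → sgn (suc q ℕ.+ j) * (+ (t C (suc q ℕ.+ j)) - + (t C (q ∸ j)))) ≡ -1ℤ
  alternating-reflected-sum q (suc t) _ t<2q = begin
    ∑< q (λ j → sgn (suc q ℕ.+ j) * (+ (suc t C (suc q ℕ.+ j)) - + (suc t C (q ∸ j))))
      ≡⟨ ∑<-cong q reflect ⟩
    ∑< q (λ j → g (suc q ℕ.+ j) + g (suc (q ∸ suc j)))
      ≡⟨ ∑<-distrib-+ q _ _ ⟩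
    ∑< q (λ j → g (suc q ℕ.+ j)) + ∑< q (λ j → g (suc (q ∸ suc j)))
      ≡⟨ cong (_+_ (∑< q (λ j → g (suc q ℕ.+ j)))) (∑<-reverse q (λ i → g (suc i))) ⟩
    ∑< q (λ j → g (suc q ℕ.+ j)) + ∑< q (λ i → g (suc i))
      ≡⟨ +-comm (∑< q (λ j → g (suc q ℕ.+ j))) _ ⟩
    ∑< q (λ i → g (suc i)) + ∑< q (λ j → g (suc q ℕ.+ j))
      ≡⟨ ∑<-split q q (λ i → g (suc i)) ⟨
    tail-sum
      ≡⟨ solve 1 (λ x → x := :- con (+ 1) :+ (con (+ 1) :+ x)) refl tail-sum ⟩
    -1ℤ + (+ 1 + tail-sum)
      ≡⟨ cong (_+_ -1ℤ) full-sum≡0 ⟩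
    -1ℤ ∎
    where
    g : ℕ → ℤ
    g i = sgn i * + (suc t C i)
    tail-sum = ∑< (q ℕ.+ q) (λ i → g (suc i))
    full-sum≡0 : + 1 + tail-sum ≡ + 0
    full-sum≡0 = begin
      ∑< (suc (q ℕ.+ q)) g                 ≡⟨ alternating-partial-sum t (q ℕ.+ q) ⟩
      sgn (q ℕ.+ q) * + (t C (q ℕ.+ q))    ≡⟨ cong (λ z → sgn (q ℕ.+ q) * + z) (k>n⇒nCk≡0 t<2q) ⟩
      sgn (q ℕ.+ q) * + 0                  ≡⟨ *-zeroʳ (sgn (q ℕ.+ q)) ⟩
      + 0                                  ∎
    reflect : ∀ j → j < q → sgn (suc q ℕ.+ j) * (+ (suc t C (suc q ℕ.+ j)) - + (suc t C (q ∸ j)))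
                            ≡ g (suc q ℕ.+ j) + g (suc (q ∸ suc j))
    reflect j j<q = begin
      sgn (suc q ℕ.+ j) * (+ (suc t C (suc q ℕ.+ j)) - + (suc t C (q ∸ j)))
        ≡⟨ solve 3 (λ s a b → s :* (a :- b) := s :* a :+ (:- s) :* b) refl
                 (sgn (suc q ℕ.+ j)) (+ (suc t C (suc q ℕ.+ j))) (+ (suc t C (q ∸ j))) ⟩
      g (suc q ℕ.+ j) + - sgn (suc q ℕ.+ j) * + (suc t C (q ∸ j))
        ≡⟨ cong (λ z → g (suc q ℕ.+ j) + - z * + (suc t C (q ∸ j))) (sgn-reflect q j (ℕ.<⇒≤ j<q)) ⟩
      g (suc q ℕ.+ j) + - - sgn (q ∸ j) * + (suc t C (q ∸ j))
        ≡⟨ cong (λ z → g (suc q ℕ.+ j) + z * + (suc t C (q ∸ j))) (neg-involutive (sgn (q ∸ j))) ⟩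
      g (suc q ℕ.+ j) + g (q ∸ j)
        ≡⟨ cong (λ z → g (suc q ℕ.+ j) + g z) (ℕ.+-∸-assoc 1 j<q) ⟩
      g (suc q ℕ.+ j) + g (suc (q ∸ suc j)) ∎

module SubsetElements where

  open Multinomials using (Ascending)
  open import Data.Bool using (Bool; true; false)
  open import Data.Empty using (⊥-elim)
  open import Data.Product using (∃₂; _,_)
  open import Data.Nat using (ℕ; zero; suc; _≤_; z≤n; s≤s)
  open import Data.Nat.Properties using (≤-trans)
  open import Data.List using (List; []; _∷_; _++_; map; filterᵇ; tabulate; allFin; initLast; _∷ʳ′_)
  open import Data.List.Properties using (map-∘)
  open import Data.List.Relation.Unary.All using (All; []; _∷_)
  open import Data.List.Relation.Unary.All.Properties using (map⁺)
  import Data.List.Relation.Unary.All as All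
  open import Data.Fin using (Fin; toℕ)
  open import Data.Fin.Subset using (Subset; Nonempty)
  open import Data.Vec using ([]; _∷_; lookup; there)
  open import Function using (_∘_)
  open import Relation.Binary.PropositionalEquality

  private
    map-filterᵇ-tabulate : ∀ {k} m (f : Fin m → Fin k) (p : Fin k → Bool) (h : Fin k → ℕ) →
      map h (filterᵇ p (tabulate f)) ≡ map (h ∘ f) (filterᵇ (p ∘ f) (allFin m))
    map-filterᵇ-tabulate zero    f p h = refl
    map-filterᵇ-tabulate (suc m) f p h with p (f Fin.zero)
    ... | true  = cong (h (f Fin.zero) ∷_) (trans (map-filterᵇ-tabulate m (f ∘ Fin.suc) p h)
                                                  (sym (map-filterᵇ-tabulate m Fin.suc (p ∘ f) (h ∘ f))))
    ... | false = trans (map-filterᵇ-tabulate m (f ∘ Fin.suc) p h) (sym (map-filterᵇ-tabulate m Fin.suc (p ∘ f) (h ∘ f)))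

    elemsOf-tail : ∀ {m} b (v : Subset m) →
      map (suc ∘ toℕ) (filterᵇ (lookup (b ∷ v)) (tabulate Fin.suc)) ≡ map suc (elemsOf v)
    elemsOf-tail {m} b v = trans (map-filterᵇ-tabulate m Fin.suc (lookup (b ∷ v)) (suc ∘ toℕ))
                                 (map-∘ (filterᵇ (lookup v) (allFin m)))

  elemsOf-true∷ : ∀ {m} (v : Subset m) → elemsOf (true ∷ v) ≡ 1 ∷ map suc (elemsOf v)
  elemsOf-true∷ v = cong (1 ∷_) (elemsOf-tail true v)

  elemsOf-false∷ : ∀ {m} (v : Subset m) → elemsOf (false ∷ v) ≡ map suc (elemsOf v)
  elemsOf-false∷ v = elemsOf-tail false v

  private
    ascending-map-suc : ∀ p xs → Ascending p xs → Ascending (suc p) (map suc xs)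
    ascending-map-suc p []       _           = _
    ascending-map-suc p (x ∷ xs) (p<x , asc) = s≤s p<x , ascending-map-suc x xs asc

    ascending-weaken : ∀ {p p′} xs → p ≤ p′ → Ascending p′ xs → Ascending p xs
    ascending-weaken []       _    _            = _
    ascending-weaken (x ∷ xs) p≤p′ (p′<x , asc) = ≤-trans (s≤s p≤p′) p′<x , asc

  elemsOf-ascending : ∀ {m} (S : Subset m) → Ascending 0 (elemsOf S)
  elemsOf-ascending []          = _
  elemsOf-ascending (true ∷ v)  = subst (Ascending 0) (sym (elemsOf-true∷ v))
    (s≤s z≤n , ascending-map-suc 0 (elemsOf v) (elemsOf-ascending v))
  elemsOf-ascending (false ∷ v) = subst (Ascending 0) (sym (elemsOf-false∷ v))
    (ascending-weaken (map suc (elemsOf v)) z≤n (ascending-map-suc 0 (elemsOf v) (elemsOf-ascending v)))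

  elemsOf-bounded : ∀ {m} (S : Subset m) → All (_≤ m) (elemsOf S)
  elemsOf-bounded []          = []
  elemsOf-bounded (true ∷ v)  = subst (All (_≤ _)) (sym (elemsOf-true∷ v)) (s≤s z≤n ∷ map⁺ (All.map s≤s (elemsOf-bounded v)))
  elemsOf-bounded (false ∷ v) = subst (All (_≤ _)) (sym (elemsOf-false∷ v)) (map⁺ (All.map s≤s (elemsOf-bounded v)))

  elemsOf-≢[] : ∀ {m} (S : Subset m) → Nonempty S → elemsOf S ≢ []
  elemsOf-≢[] (true ∷ v)  _                        eq with () ← trans (sym (elemsOf-true∷ v)) eq
  elemsOf-≢[] (false ∷ v) (Fin.suc x , there x∈v) eq = elemsOf-≢[] v (x , x∈v) (map-≡[] (trans (sym (elemsOf-false∷ v)) eq))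
    where
    map-≡[] : ∀ {xs : List ℕ} → map suc xs ≡ [] → xs ≡ []
    map-≡[] {[]} _ = refl

  elemsOf-snoc : ∀ {m} (S : Subset m) → Nonempty S → ∃₂ λ rs s → elemsOf S ≡ rs ++ s ∷ []
  elemsOf-snoc S S≢∅ with elemsOf S | elemsOf-≢[] S S≢∅ | initLast (elemsOf S)
  ... | _ | ≢[] | []       = ⊥-elim (≢[] refl)
  ... | _ | _   | rs ∷ʳ′ s = rs , s , refl

  maxOf-snoc : ∀ rs s → maxOf (rs ++ s ∷ []) ≡ s
  maxOf-snoc []           s = refl
  maxOf-snoc (r ∷ [])     s = refl
  maxOf-snoc (r ∷ r′ ∷ rs) s = maxOf-snoc (r′ ∷ rs) s

open ListSums using (χ)
open NatTests
open Faces using (missesUpTo; inBoundaryOf)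
open SubsetCounts using (count; supersets; count-missesUpTo-suc; count-inBoundaryOf-suc)
open Multinomials
open FaceChains using (chainsBetween; chainsAbove-bot; chainsBetween-bot-tau)
open AlternatingSums
open SubsetElements
open import Data.Product using (_,_)
open import Data.Sum using (inj₁; inj₂)
open import Data.Nat as ℕ using (ℕ; suc; _∸_; _≤_; _<_; s≤s; _≡ᵇ_; _/_; _%_)
open import Data.Nat.DivMod using (m≡m%n+[m/n]*n)
import Data.Nat.Properties as ℕ
open import Data.Nat.Combinatorics using (_C_; nCn≡1; k>n⇒nCk≡0)
open import Data.Integer using (ℤ; +_; _+_; _*_; _-_; -1ℤ)
open import Data.Integer.Properties
open import Data.Integer.Solver using (module +-*-Solver)
open import Data.List using (List; []; _∷_; _++_; initLast; _∷ʳ′_)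
open import Data.List.Properties using (≡-dec; ∷ʳ-injectiveˡ)
open import Data.List.Relation.Unary.All using (All; _∷_)
open import Data.List.Relation.Unary.All.Properties using (++⁻ʳ)
open import Data.Fin.Subset using (Subset; Nonempty)
open import Relation.Binary.PropositionalEquality
open import Relation.Nullary using (yes; no; contradiction)
open ≡-Reasoning
open +-*-Solver using (solve; _:+_; _:*_; :-_; _:-_; _:=_; con)

private
  cancel-shared-summand : ∀ a p m x y → + ((a ℕ.+ p) ℕ.* m ℕ.+ x) - + (a ℕ.* m ℕ.+ y) ≡ + (p ℕ.* m) + (+ x - + y)
  cancel-shared-summand a p m x y = begin
    + ((a ℕ.+ p) ℕ.* m ℕ.+ x) - + (a ℕ.* m ℕ.+ y)
      ≡⟨ cong₂ _-_ (trans (pos-+ _ x) (cong (_+ + x) (trans (pos-* (a ℕ.+ p) m) (cong (_* + m) (pos-+ a p)))))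
                   (trans (pos-+ _ y) (cong (_+ + y) (pos-* a m))) ⟩
    ((+ a + + p) * + m + + x) - (+ a * + m + + y)
      ≡⟨ solve 5 (λ a p m x y → ((a :+ p) :* m :+ x) :- (a :* m :+ y) := p :* m :+ (x :- y)) refl (+ a) (+ p) (+ m) (+ x) (+ y) ⟩
    + p * + m + (+ x - + y)
      ≡⟨ cong (_+ (+ x - + y)) (pos-* p m) ⟨
    + (p ℕ.* m) + (+ x - + y) ∎

  sgn-rescale : ∀ σ c p m k₁ k₂ → c ℕ.* p ≡ k₁ ℕ.* k₂ → σ * + c * + (p ℕ.* m) ≡ (+ k₁ * + m) * (σ * + k₂)
  sgn-rescale σ c p m k₁ k₂ cp≡k₁k₂ = begin
    σ * + c * + (p ℕ.* m)   ≡⟨ cong (σ * + c *_) (pos-* p m) ⟩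
    σ * + c * (+ p * + m)   ≡⟨ solve 4 (λ σ c p m → σ :* c :* (p :* m) := σ :* (c :* p) :* m) refl σ (+ c) (+ p) (+ m) ⟩
    σ * (+ c * + p) * + m   ≡⟨ cong (λ z → σ * z * + m) (trans (sym (pos-* c p)) (trans (cong +_ cp≡k₁k₂) (pos-* k₁ k₂))) ⟩
    σ * (+ k₁ * + k₂) * + m ≡⟨ solve 4 (λ σ a b m → σ :* (a :* b) :* m := (a :* m) :* (σ :* b)) refl σ (+ k₁) (+ k₂) (+ m) ⟩
    (+ k₁ * + m) * (σ * + k₂) ∎

  pos-difference : ∀ b b′ p q m → b ℕ.+ q ≡ b′ ℕ.+ p → + (b ℕ.* m) - + (b′ ℕ.* m) ≡ (+ p - + q) * + m
  pos-difference b b′ p q m b+q≡b′+p = begin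
    + (b ℕ.* m) - + (b′ ℕ.* m)      ≡⟨ cong₂ _-_ (pos-* b m) (pos-* b′ m) ⟩
    + b * + m - + b′ * + m          ≡⟨ cong (λ z → z * + m - + b′ * + m) +b≡ ⟩
    (+ b′ + + p - + q) * + m - + b′ * + m
      ≡⟨ solve 4 (λ b p q m → (b :+ p :- q) :* m :- b :* m := (p :- q) :* m) refl (+ b′) (+ p) (+ q) (+ m) ⟩
    (+ p - + q) * + m               ∎
    where
    +b≡ : + b ≡ + b′ + + p - + q
    +b≡ = begin
      + b                   ≡⟨ solve 2 (λ b q → b := b :+ q :- q) refl (+ b) (+ q) ⟩
      + b + + q - + q       ≡⟨ cong (_- + q) (trans (sym (pos-+ b q)) (trans (cong +_ b+q≡b′+p) (pos-+ b′ p))) ⟩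
      + b′ + + p - + q      ∎

  sgn-rescale-difference : ∀ σ a p q m k x y → a ℕ.* p ≡ k ℕ.* x → a ℕ.* q ≡ k ℕ.* y →
                           σ * + a * ((+ p - + q) * + m) ≡ (+ k * + m) * (σ * (+ x - + y))
  sgn-rescale-difference σ a p q m k x y ap≡kx aq≡ky = begin
    σ * + a * ((+ p - + q) * + m)
      ≡⟨ solve 5 (λ σ a p q m → σ :* a :* ((p :- q) :* m) := σ :* (a :* p :- a :* q) :* m) refl σ (+ a) (+ p) (+ q) (+ m) ⟩
    σ * (+ a * + p - + a * + q) * + m
      ≡⟨ cong₂ (λ u v → σ * (u - v) * + m) (pos-*-≡ a p k x ap≡kx) (pos-*-≡ a q k y aq≡ky) ⟩
    σ * (+ k * + x - + k * + y) * + m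
      ≡⟨ solve 5 (λ σ k x y m → σ :* (k :* x :- k :* y) :* m := (k :* m) :* (σ :* (x :- y))) refl σ (+ k) (+ x) (+ y) (+ m) ⟩
    (+ k * + m) * (σ * (+ x - + y)) ∎
    where
    pos-*-≡ : ∀ a p k x → a ℕ.* p ≡ k ℕ.* x → + a * + p ≡ + k * + x
    pos-*-≡ a p k x e = trans (sym (pos-* a p)) (trans (cong +_ e) (pos-* k x))

delta-≡ : ∀ {n} (S : Subset n) → elemsOf S ≡ n ∷ [] → delta n S ≡ + 1
delta-≡ {n} S elems≡[n] with ≡-dec ℕ._≟_ (elemsOf S) (n ∷ [])
... | yes _        = refl
... | no  elems≢[n] = contradiction elems≡[n] elems≢[n]

delta-≢ : ∀ {n} (S : Subset n) → elemsOf S ≢ n ∷ [] → delta n S ≡ + 0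
delta-≢ {n} S elems≢[n] with ≡-dec ℕ._≟_ (elemsOf S) (n ∷ [])
... | yes elems≡[n] = contradiction elems≡[n] elems≢[n]
... | no  _         = refl

AlternatingIdentity : (n q : ℕ) → Subset n → Set
AlternatingIdentity n q S =
  sumRange (suc q) (n ∸ 1) (λ i → sgn i * + (n C i) * fCheck n i S)
    ≡ + (n C maxOf (elemsOf S)) * + multinomial (gapsFrom 0 (elemsOf S))
        * sumRange (suc q) (maxOf (elemsOf S)) (λ j → sgn j * + (maxOf (elemsOf S) C j))
      + delta n S

module Decomposition (q : ℕ) (S : Subset (suc (q ℕ.+ q))) (rs : List ℕ) (s : ℕ) (elems≡ : elemsOf S ≡ rs ++ s ∷ []) where

  n : ℕ
  n = suc (q ℕ.+ q)

  ascending : Ascending 0 (rs ++ s ∷ [])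
  ascending = subst (Ascending 0) elems≡ (elemsOf-ascending S)

  s≤n : s ≤ n
  s≤n with ++⁻ʳ rs (subst (All (_≤ n)) elems≡ (elemsOf-bounded S))
  ... | s≤n ∷ _ = s≤n

  M : ℕ
  M = multinomialGaps 0 rs s

  X : ℕ → ℕ
  X i = χ (n ≡ᵇ s) (chainsBetween n i bot tau rs)

  Δ : ℕ → ℤ
  Δ i = sgn i * + (n C i) * (+ X i - + X (ℕ.pred i))

  g : ℕ → ℤ
  g j = sgn j * + (s C j)

  c : ℤ
  c = + (n C s) * + M

  flagF≡ : ∀ i → i < n → flagF n i S ≡ count (suc n) (missesUpTo i) s ℕ.* M ℕ.+ X i
  flagF≡ i i<n = trans (cong (chainsAbove n i bot) elems≡) (chainsAbove-bot n i i<n rs s ascending)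

  fCheck-suc : ∀ i → suc i < n →
               fCheck n (suc i) S ≡ + (supersets (n ∸ suc i) (suc i) s ℕ.* M) + (+ X (suc i) - + X i)
  fCheck-suc i i+1<n = begin
    + flagF n (suc i) S - + flagF n i S
      ≡⟨ cong₂ (λ a b → + a - + b) (flagF≡ (suc i) i+1<n) (flagF≡ i (ℕ.<-trans (ℕ.n<1+n i) i+1<n)) ⟩
    + (count (suc n) (missesUpTo (suc i)) s ℕ.* M ℕ.+ X (suc i)) - + (Γᵢ ℕ.* M ℕ.+ X i)
      ≡⟨ cong (λ z → + (z ℕ.* M ℕ.+ X (suc i)) - + (Γᵢ ℕ.* M ℕ.+ X i)) (count-missesUpTo-suc i (ℕ.m<n⇒m<1+n i+1<n) s) ⟩
    + ((Γᵢ ℕ.+ supersets (n ∸ suc i) (suc i) s) ℕ.* M ℕ.+ X (suc i)) - + (Γᵢ ℕ.* M ℕ.+ X i)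
      ≡⟨ cancel-shared-summand Γᵢ _ M (X (suc i)) (X i) ⟩
    + (supersets (n ∸ suc i) (suc i) s ℕ.* M) + (+ X (suc i) - + X i) ∎
    where Γᵢ = count (suc n) (missesUpTo i) s

  summand≡ : ∀ i → suc i < n → sgn (suc i) * + (n C suc i) * fCheck n (suc i) S ≡ c * g (suc i) + Δ (suc i)
  summand≡ i i+1<n = begin
    σ * fCheck n (suc i) S
      ≡⟨ cong (σ *_) (fCheck-suc i i+1<n) ⟩
    σ * (+ (supersets (n ∸ suc i) (suc i) s ℕ.* M) + (+ X (suc i) - + X i))
      ≡⟨ *-distribˡ-+ σ _ _ ⟩
    σ * + (supersets (n ∸ suc i) (suc i) s ℕ.* M) + Δ (suc i)
      ≡⟨ cong (_+ Δ (suc i)) (sgn-rescale (sgn (suc i)) (n C suc i) _ M (n C s) (s C suc i)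
                                          (nCi*supersets≡nCs*sCi n (suc i) s≤n)) ⟩
    c * g (suc i) + Δ (suc i) ∎
    where σ = sgn (suc i) * + (n C suc i)

  lhs≡ : sumRange (suc q) (n ∸ 1) (λ i → sgn i * + (n C i) * fCheck n i S)
         ≡ c * ∑< q (λ j → g (suc q ℕ.+ j)) + ∑< q (λ j → Δ (suc q ℕ.+ j))
  lhs≡ = begin
    sumRange (suc q) (q ℕ.+ q) F
      ≡⟨ sumRange≡∑< (suc q) (q ℕ.+ q) F ⟩
    ∑< ((q ℕ.+ q) ∸ q) (λ j → F (suc q ℕ.+ j))
      ≡⟨ cong (λ k → ∑< k (λ j → F (suc q ℕ.+ j))) (ℕ.m+n∸m≡n q q) ⟩
    ∑< q (λ j → F (suc q ℕ.+ j))
      ≡⟨ ∑<-cong q (λ j j<q → summand≡ (q ℕ.+ j) (s≤s (ℕ.+-monoʳ-< q j<q))) ⟩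
    ∑< q (λ j → c * g (suc q ℕ.+ j) + Δ (suc q ℕ.+ j))
      ≡⟨ ∑<-distrib-+ q _ _ ⟩
    ∑< q (λ j → c * g (suc q ℕ.+ j)) + ∑< q (λ j → Δ (suc q ℕ.+ j))
      ≡⟨ cong (_+ ∑< q (λ j → Δ (suc q ℕ.+ j))) (∑<-*ˡ q c _) ⟩
    c * ∑< q (λ j → g (suc q ℕ.+ j)) + ∑< q (λ j → Δ (suc q ℕ.+ j)) ∎
    where
    F : ℕ → ℤ
    F i = sgn i * + (n C i) * fCheck n i S

  rhs≡ : + (n C maxOf (elemsOf S)) * + multinomial (gapsFrom 0 (elemsOf S))
           * sumRange (suc q) (maxOf (elemsOf S)) (λ j → sgn j * + (maxOf (elemsOf S) C j)) + delta n S
         ≡ c * ∑< (s ∸ q) (λ j → g (suc q ℕ.+ j)) + delta n S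
  rhs≡ = begin
    _ ≡⟨ cong (λ xs → + (n C maxOf xs) * + multinomial (gapsFrom 0 xs)
                        * sumRange (suc q) (maxOf xs) (λ j → sgn j * + (maxOf xs C j)) + delta n S) elems≡ ⟩
    _ ≡⟨ cong (λ m → + (n C m) * + M * sumRange (suc q) m (λ j → sgn j * + (m C j)) + delta n S) (maxOf-snoc rs s) ⟩
    _ ≡⟨ cong (λ z → c * z + delta n S) (sumRange≡∑< (suc q) s g) ⟩
    _ ∎

  Δ-const : ∀ {k} → (∀ i → X i ≡ k) → ∀ i → Δ i ≡ + 0
  Δ-const {k} X≡k i = begin
    sgn i * + (n C i) * (+ X i - + X (ℕ.pred i))
      ≡⟨ cong₂ (λ a b → sgn i * + (n C i) * (+ a - + b)) (X≡k i) (X≡k (ℕ.pred i)) ⟩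
    sgn i * + (n C i) * (+ k - + k)
      ≡⟨ cong (sgn i * + (n C i) *_) (+-inverseʳ (+ k)) ⟩
    sgn i * + (n C i) * + 0
      ≡⟨ *-zeroʳ (sgn i * + (n C i)) ⟩
    + 0 ∎

identity-max<n : ∀ q (S : Subset (suc (q ℕ.+ q))) rs s → elemsOf S ≡ rs ++ s ∷ [] → s < suc (q ℕ.+ q) →
                 AlternatingIdentity (suc (q ℕ.+ q)) q S
identity-max<n q S rs s elems≡ s<n = begin
  _ ≡⟨ lhs≡ ⟩
  c * ∑< q g′ + ∑< q Δ′
    ≡⟨ cong₂ _+_ (cong (c *_) (∑<-truncate g′ s∸q≤q g′-vanishes)) (∑<-zero q (λ j _ → Δ-const X≡0 (suc q ℕ.+ j))) ⟩
  c * ∑< (s ∸ q) g′ + + 0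
    ≡⟨ cong (_+_ (c * ∑< (s ∸ q) g′)) (delta-≢ S elems≢[n]) ⟨
  c * ∑< (s ∸ q) g′ + delta n S
    ≡⟨ rhs≡ ⟨
  _ ∎
  where
  open Decomposition q S rs s elems≡
  g′ Δ′ : ℕ → ℤ
  g′ j = g (suc q ℕ.+ j)
  Δ′ j = Δ (suc q ℕ.+ j)
  X≡0 : ∀ i → X i ≡ 0
  X≡0 i = cong (λ b → χ b (chainsBetween n i bot tau rs)) (≢⇒≡ᵇ-false (ℕ.>⇒≢ s<n))
  s∸q≤q : s ∸ q ≤ q
  s∸q≤q = ℕ.≤-trans (ℕ.∸-monoˡ-≤ q (ℕ.≤-pred s<n)) (ℕ.≤-reflexive (ℕ.m+n∸m≡n q q))
  g′-vanishes : ∀ j → s ∸ q ≤ j → g′ j ≡ + 0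
  g′-vanishes j s∸q≤j = trans (cong (λ z → sgn (suc q ℕ.+ j) * + z) (k>n⇒nCk≡0 s<1+q+j)) (*-zeroʳ (sgn (suc q ℕ.+ j)))
    where s<1+q+j = s≤s (ℕ.≤-trans (ℕ.m≤n+m∸n s q) (ℕ.+-monoʳ-≤ q s∸q≤j))
  elems≢[n] : elemsOf S ≢ n ∷ []
  elems≢[n] elems≡[n] = ℕ.<-irrefl (trans (sym (maxOf-snoc rs s)) (cong maxOf (trans (sym elems≡) elems≡[n]))) s<n

private
  ∑<-top : ∀ q (f : ℕ → ℤ) →
           ∑< (suc (q ℕ.+ q) ∸ q) (λ j → f (suc q ℕ.+ j)) ≡ ∑< q (λ j → f (suc q ℕ.+ j)) + f (suc (q ℕ.+ q))
  ∑<-top q f = trans (cong (λ k → ∑< k (λ j → f (suc q ℕ.+ j))) n∸q≡1+q) (∑<-snoc q (λ j → f (suc q ℕ.+ j)))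
    where
    n∸q≡1+q : suc (q ℕ.+ q) ∸ q ≡ suc q
    n∸q≡1+q = trans (ℕ.+-∸-assoc 1 (ℕ.m≤m+n q q)) (cong suc (ℕ.m+n∸m≡n q q))

  g-n≡-1 : ∀ q → sgn (suc (q ℕ.+ q)) * + (suc (q ℕ.+ q) C suc (q ℕ.+ q)) ≡ -1ℤ
  g-n≡-1 q = cong₂ (λ a b → a * + b) (sgn-odd q) (nCn≡1 (suc (q ℕ.+ q)))

identity-singleton : ∀ q (S : Subset (suc (q ℕ.+ q))) → elemsOf S ≡ suc (q ℕ.+ q) ∷ [] →
                     AlternatingIdentity (suc (q ℕ.+ q)) q S
identity-singleton q S elems≡ = begin
  _ ≡⟨ lhs≡ ⟩
  c * ∑< q g′ + ∑< q Δ′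
    ≡⟨ cong₂ (λ a b → a * ∑< q g′ + b) c≡1 (∑<-zero q (λ j _ → Δ-const X≡1 (suc q ℕ.+ j))) ⟩
  + 1 * ∑< q g′ + + 0
    ≡⟨ solve 1 (λ T → con (+ 1) :* T :+ con (+ 0) := con (+ 1) :* (T :+ :- con (+ 1)) :+ con (+ 1)) refl (∑< q g′) ⟩
  + 1 * (∑< q g′ + -1ℤ) + + 1
    ≡⟨ cong₂ (λ a b → a * (∑< q g′ + b) + + 1) c≡1 (g-n≡-1 q) ⟨
  c * (∑< q g′ + g n) + + 1
    ≡⟨ cong₂ (λ a b → c * a + b) (∑<-top q g) (delta-≡ S elems≡) ⟨
  c * ∑< (n ∸ q) g′ + delta n S
    ≡⟨ rhs≡ ⟨
  _ ∎
  where
  open Decomposition q S [] (suc (q ℕ.+ q)) elems≡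
  g′ Δ′ : ℕ → ℤ
  g′ j = g (suc q ℕ.+ j)
  Δ′ j = Δ (suc q ℕ.+ j)
  X≡1 : ∀ i → X i ≡ 1
  X≡1 i = cong (λ b → χ b 1) (≡⇒≡ᵇ-true {n} refl)
  c≡1 : c ≡ + 1
  c≡1 = cong₂ (λ a b → + a * + b) (nCn≡1 n) (multinomialGaps-[] 0 n)

module TopChains (q : ℕ) (S : Subset (suc (q ℕ.+ q))) (rs : List ℕ) (t : ℕ)
                 (elems≡ : elemsOf S ≡ (rs ++ t ∷ []) ++ suc (q ℕ.+ q) ∷ []) where

  open Decomposition q S (rs ++ t ∷ []) (suc (q ℕ.+ q)) elems≡

  ascending-t : Ascending 0 (rs ++ t ∷ [])
  ascending-t = ascending-init 0 (rs ++ t ∷ []) (n ∷ []) ascending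

  t<n : t < n
  t<n = ascending-penultimate 0 rs t n ascending

  M′ : ℕ
  M′ = multinomialGaps 0 rs t

  c≡ : c ≡ + (n C t) * + M′
  c≡ = begin
    + (n C n) * + M                ≡⟨ cong (λ a → + a * + M) (nCn≡1 n) ⟩
    + 1 * + M                      ≡⟨ *-identityˡ (+ M) ⟩
    + M                            ≡⟨ cong +_ (multinomialGaps-snoc 0 rs t n ascending) ⟩
    + (M′ ℕ.* (n C t))             ≡⟨ pos-* M′ (n C t) ⟩
    + M′ * + (n C t)               ≡⟨ *-comm (+ M′) (+ (n C t)) ⟩
    + (n C t) * + M′               ∎

  ∂Γ : ℕ → ℕ
  ∂Γ i = count (suc n) (inBoundaryOf i) t

  X≡ : ∀ i → i < n → X i ≡ ∂Γ i ℕ.* M′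
  X≡ i i<n = trans (cong (λ b → χ b (chainsBetween n i bot tau (rs ++ t ∷ []))) (≡⇒≡ᵇ-true {n} refl))
                   (chainsBetween-bot-tau n i i<n rs t ascending-t)

  Δ≡ : ∀ i → suc i < n →
       Δ (suc i) ≡ (+ (n C t) * + M′) * (sgn (suc i) * (+ (t C suc i) - + (t C (n ∸ suc i))))
  Δ≡ i i+1<n = begin
    sgn (suc i) * + (n C suc i) * (+ X (suc i) - + X i)
      ≡⟨ cong₂ (λ a b → sgn (suc i) * + (n C suc i) * (+ a - + b)) (X≡ (suc i) i+1<n) (X≡ i i<n) ⟩
    sgn (suc i) * + (n C suc i) * (+ (∂Γ (suc i) ℕ.* M′) - + (∂Γ i ℕ.* M′))
      ≡⟨ cong (sgn (suc i) * + (n C suc i) *_)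
              (pos-difference (∂Γ (suc i)) (∂Γ i) _ _ M′
                              (count-inBoundaryOf-suc i (ℕ.m<n⇒m<1+n i+1<n) (ℕ.m<n⇒m<1+n t<n))) ⟩
    sgn (suc i) * + (n C suc i) * ((+ supersets (n ∸ suc i) (suc i) t - + supersets (suc i) (n ∸ suc i) t) * + M′)
      ≡⟨ sgn-rescale-difference (sgn (suc i)) (n C suc i) _ _ M′ (n C t) (t C suc i) (t C (n ∸ suc i))
                                (nCi*supersets≡nCs*sCi n (suc i) (ℕ.<⇒≤ t<n))
                                (nCi*supersets≡nCt*tC[n∸i] (ℕ.<⇒≤ i+1<n) (ℕ.<⇒≤ t<n)) ⟩
    (+ (n C t) * + M′) * (sgn (suc i) * (+ (t C suc i) - + (t C (n ∸ suc i)))) ∎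
    where i<n = ℕ.<-trans (ℕ.n<1+n i) i+1<n

  ∑Δ≡-c : ∑< q (λ j → Δ (suc q ℕ.+ j)) ≡ c * -1ℤ
  ∑Δ≡-c = begin
    ∑< q (λ j → Δ (suc q ℕ.+ j))
      ≡⟨ ∑<-cong q (λ j j<q → trans (Δ≡ (q ℕ.+ j) (s≤s (ℕ.+-monoʳ-< q j<q)))
                                     (cong (λ z → k * e j z) (ℕ.[m+n]∸[m+o]≡n∸o q q j))) ⟩
    ∑< q (λ j → k * e j (q ∸ j))
      ≡⟨ ∑<-*ˡ q k _ ⟩
    k * ∑< q (λ j → e j (q ∸ j))
      ≡⟨ cong (k *_) (alternating-reflected-sum q t (ascending-last 0 rs t ascending-t) (ℕ.≤-pred t<n)) ⟩
    k * -1ℤ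
      ≡⟨ cong (_* -1ℤ) c≡ ⟨
    c * -1ℤ ∎
    where
    k = + (n C t) * + M′
    e : ℕ → ℕ → ℤ
    e j l = sgn (suc q ℕ.+ j) * (+ (t C (suc q ℕ.+ j)) - + (t C l))

  elems≢[n] : elemsOf S ≢ n ∷ []
  elems≢[n] elems≡[n] = ∷ʳ≢[] rs t (∷ʳ-injectiveˡ (rs ++ t ∷ []) [] (trans (sym elems≡) elems≡[n]))
    where
    ∷ʳ≢[] : ∀ xs (x : ℕ) → xs ++ x ∷ [] ≢ []
    ∷ʳ≢[] []      x ()
    ∷ʳ≢[] (_ ∷ _) x ()

identity-max≡n : ∀ q (S : Subset (suc (q ℕ.+ q))) rs t → elemsOf S ≡ (rs ++ t ∷ []) ++ suc (q ℕ.+ q) ∷ [] →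
                 AlternatingIdentity (suc (q ℕ.+ q)) q S
identity-max≡n q S rs t elems≡ = begin
  _ ≡⟨ lhs≡ ⟩
  c * ∑< q g′ + ∑< q (λ j → Δ (suc q ℕ.+ j))
    ≡⟨ cong (_+_ (c * ∑< q g′)) ∑Δ≡-c ⟩
  c * ∑< q g′ + c * -1ℤ
    ≡⟨ solve 2 (λ c T → c :* T :+ c :* :- con (+ 1) := c :* (T :+ :- con (+ 1)) :+ con (+ 0)) refl c (∑< q g′) ⟩
  c * (∑< q g′ + -1ℤ) + + 0
    ≡⟨ cong₂ (λ a b → c * (∑< q g′ + a) + b) (g-n≡-1 q) (delta-≢ S elems≢[n]) ⟨
  c * (∑< q g′ + g n) + delta n S
    ≡⟨ cong (λ z → c * z + delta n S) (∑<-top q g) ⟨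
  c * ∑< (n ∸ q) g′ + delta n S
    ≡⟨ rhs≡ ⟨
  _ ∎
  where
  open TopChains q S rs t elems≡
  open Decomposition q S (rs ++ t ∷ []) (suc (q ℕ.+ q)) elems≡
  g′ : ℕ → ℤ
  g′ j = g (suc q ℕ.+ j)

alternating-identity : ∀ q (S : Subset (suc (q ℕ.+ q))) → Nonempty S → AlternatingIdentity (suc (q ℕ.+ q)) q S
alternating-identity q S S≢∅ with elemsOf-snoc S S≢∅
... | rs , s , elems≡ with ℕ.m≤n⇒m<n∨m≡n (Decomposition.s≤n q S rs s elems≡)
...   | inj₁ s<n = identity-max<n q S rs s elems≡ s<n
...   | inj₂ refl with initLast rs
...     | []        = identity-singleton q S elems≡
...     | rs′ ∷ʳ′ t = identity-max≡n q S rs′ t elems≡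

odd⇒≡1+2[n/2] : ∀ n → n % 2 ≡ 1 → n ≡ suc (n / 2 ℕ.+ n / 2)
odd⇒≡1+2[n/2] n n%2≡1 = begin
  n                             ≡⟨ m≡m%n+[m/n]*n n 2 ⟩
  n % 2 ℕ.+ n / 2 ℕ.* 2         ≡⟨ cong (ℕ._+ n / 2 ℕ.* 2) n%2≡1 ⟩
  suc (n / 2 ℕ.* 2)             ≡⟨ cong suc (ℕ.*-comm (n / 2) 2) ⟩
  suc (n / 2 ℕ.+ (n / 2 ℕ.+ 0)) ≡⟨ cong (λ m → suc (n / 2 ℕ.+ m)) (ℕ.+-identityʳ (n / 2)) ⟩
  suc (n / 2 ℕ.+ n / 2)         ∎

lemma3p7 : (n : ℕ) → n % 2 ≡ 1 → (S : Subset n) → Nonempty S →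
    sumRange (suc (n / 2)) (n ∸ 1) (λ i → sgn i * + (n C i) * fCheck n i S)
      ≡ + (n C maxOf (elemsOf S)) * + multinomial (gapsFrom 0 (elemsOf S))
          * sumRange (suc (n / 2)) (maxOf (elemsOf S)) (λ j → sgn j * + (maxOf (elemsOf S) C j))
        + delta n S
lemma3p7 n n%2≡1 = odd n (n / 2) (odd⇒≡1+2[n/2] n n%2≡1)
  where
  odd : ∀ n q → n ≡ suc (q ℕ.+ q) → (S : Subset n) → Nonempty S → AlternatingIdentity n q S
  odd _ q refl = alternating-identity q
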